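{- There is a constant $c>0$ such that for every solid subgraph $G$ of the triangular lattice with $f$ bounded faces, every tower in every Eulerian orientation of $G$ has length at most $c\sqrt{f}$, i.e. the maximum length of a tower is $O(\sqrt{f})$.
   Context: Triangular lattice: vertices $v_{i,j}$ ($i,j\in\mathbb{Z}$), edges $\{v_{i,j},v_{i+1,j}\}$, $\{v_{i,j},v_{i,j+1}\}$, $\{v_{i,j},v_{i+1,j-1}\}$, with its standard planar embedding in which all bounded faces are triangles. A solid subgraph is obtained by choosing a cycle of the lattice as boundary and taking this cycle together with everything in its interior. An Eulerian orientation is an orientation with in-degree equal to out-degree at every vertex. A bounded face is directed in an orientation if its boundary edges form a directed cycle; it is almost-directed if all but one of its boundary edges have a common direction around the face, the exceptional edge being its blocking edge. A tower of length $h$ in an orientation $\sigma$ is a sequence of bounded faces $F_1,\dots,F_h$, consecutive ones sharing an edge, such that for $1\le i\le h-1$, $F_i$ is almost-directed in $\sigma$ with blocking edge the edge shared with $F_{i+1}$, and $F_h$ is directed in $\sigma$. -}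

module Defs where

open import Data.Bool using (Bool; true; false; _∧_; _∨_; not; _xor_; T)
open import Data.Nat using (ℕ; zero; suc; _≤_; _*_)
open import Data.Integer as ℤ using (ℤ; +_)
open import Data.List using (List; []; _∷_; [_]; length; filter)
open import Data.Bool.ListAction using (any)
open import Data.List.Relation.Unary.All using (All)
open import Data.List.Relation.Unary.Unique.Propositional using (Unique)
open import Data.List.Membership.Propositional using (_∈_)
open import Data.Product using (Σ; _×_; _,_; proj₁; proj₂)
open import Data.Empty using (⊥)
open import Relation.Nullary using (does; ¬_)
open import Relation.Binary.PropositionalEquality using (_≡_)
open import Function.Bundles using (_⇔_)

-- Vertex v_{i,j} is (i , j).  Edges are given by a base vertex and a
-- direction:  hor : v_{i,j} — v_{i+1,j},  ver : v_{i,j} — v_{i,j+1},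
--             dia : v_{i,j} — v_{i+1,j-1}.
-- Bounded faces of the lattice: up (i,j)   = {v_{i,j}, v_{i+1,j}, v_{i,j+1}},
--                               down (i,j) = {v_{i+1,j}, v_{i,j+1}, v_{i+1,j+1}}.

Vertex : Set
Vertex = ℤ × ℤ

data Dir : Set where
  hor ver dia : Dir

Edge : Set
Edge = ℤ × ℤ × Dir

data Orient : Set where
  up down : Orient

Face : Set
Face = ℤ × ℤ × Orient

1ℤ : ℤ
1ℤ = + 1

base : Edge → Vertex
base (i , j , _) = (i , j)

head : Edge → Vertex
head (i , j , hor) = (i ℤ.+ 1ℤ , j)
head (i , j , ver) = (i , j ℤ.+ 1ℤ)
head (i , j , dia) = (i ℤ.+ 1ℤ , j ℤ.- 1ℤ)

_==ℤ_ : ℤ → ℤ → Bool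
a ==ℤ b = does (a ℤ.≟ b)

_<ℤ_ : ℤ → ℤ → Bool
a <ℤ b = does (a ℤ.<? b)

_≤ℤ_ : ℤ → ℤ → Bool
a ≤ℤ b = does (a ℤ.≤? b)

_==ᵥ_ : Vertex → Vertex → Bool
(a , b) ==ᵥ (c , d) = (a ==ℤ c) ∧ (b ==ℤ d)

_==ᴰ_ : Dir → Dir → Bool
hor ==ᴰ hor = true
ver ==ᴰ ver = true
dia ==ᴰ dia = true
_   ==ᴰ _   = false

_==ₑ_ : Edge → Edge → Bool
(a , b , d) ==ₑ (a' , b' , d') = (a ==ℤ a') ∧ ((b ==ℤ b') ∧ (d ==ᴰ d'))

joins : Edge → Vertex → Vertex → Bool
joins e u w = ((base e ==ᵥ u) ∧ (head e ==ᵥ w)) ∨ ((base e ==ᵥ w) ∧ (head e ==ᵥ u))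

incident : Vertex → List Edge
incident (i , j) =
  (i , j , hor) ∷ (i ℤ.- 1ℤ , j , hor) ∷ (i , j , ver) ∷ (i , j ℤ.- 1ℤ , ver)
  ∷ (i , j , dia) ∷ (i ℤ.- 1ℤ , j ℤ.+ 1ℤ , dia) ∷ []

Adjacent : Vertex → Vertex → Set
Adjacent u w = Σ Edge (λ e → T (joins e u w))

steps : List Vertex → List (Vertex × Vertex)
steps [] = []
steps (w ∷ ws) = go (w ∷ ws)
  where
  go : List Vertex → List (Vertex × Vertex)
  go [] = []
  go (x ∷ []) = [ (x , w) ]
  go (x ∷ y ∷ r) = (x , y) ∷ go (y ∷ r)

IsCycle : List Vertex → Set
IsCycle C = (3 ≤ length C) × Unique C × All (λ s → Adjacent (proj₁ s) (proj₂ s)) (steps C)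

onCycle : List Vertex → Edge → Bool
onCycle C e = any (λ s → joins e (proj₁ s) (proj₂ s)) (steps C)

-- Interior of a cycle (discrete Jordan interior): a face F lies in the
-- interior of C iff the horizontal ray (direction v_{i,j} → v_{i+1,j})
-- from the centroid of F crosses an odd number of edges of C.  The ray from
-- the centroid of up (i,j) is at height j+1/3 starting at i-coordinate i+1/3;
-- from down (i,j) at height j+2/3 starting at i+2/3.  It meets no vertex and
-- crosses exactly the edges listed below.

crossesRay : Face → Edge → Bool
crossesRay (i , j , up)   (k , l , ver) = (l ==ℤ j) ∧ (i <ℤ k)
crossesRay (i , j , up)   (k , l , dia) = (l ==ℤ (j ℤ.+ 1ℤ)) ∧ (i ≤ℤ k)
crossesRay (i , j , down) (k , l , ver) = (l ==ℤ j) ∧ (i <ℤ k)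
crossesRay (i , j , down) (k , l , dia) = (l ==ℤ (j ℤ.+ 1ℤ)) ∧ (i <ℤ k)
crossesRay _              (_ , _ , hor) = false

stepCrosses : Face → Vertex × Vertex → Bool
stepCrosses F (u , w) = any (λ e → joins e u w ∧ crossesRay F e) (incident u)

crossings : List Vertex → Face → ℕ
crossings C F = length (filter (λ s → T? (stepCrosses F s)) (steps C))
  where
  open import Relation.Nullary.Decidable using (Dec)
  open import Data.Bool.Properties using () renaming (T? to T?)

oddᵇ : ℕ → Bool
oddᵇ zero = false
oddᵇ (suc n) = not (oddᵇ n)

insideᵇ : List Vertex → Face → Bool
insideᵇ C F = oddᵇ (crossings C F)

Inside : List Vertex → Face → Set
Inside C F = T (insideᵇ C F)

adjFaces : Edge → Face × Face
adjFaces (i , j , hor) = (i , j , up) , (i , j ℤ.- 1ℤ , down)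
adjFaces (i , j , ver) = (i , j , up) , (i ℤ.- 1ℤ , j , down)
adjFaces (i , j , dia) = (i , j ℤ.- 1ℤ , up) , (i , j ℤ.- 1ℤ , down)

-- edges of the solid subgraph G(C): edges of C, and edges in the interior
-- of C (both adjacent faces in the interior)
inGᵇ : List Vertex → Edge → Bool
inGᵇ C e = onCycle C e ∨ (insideᵇ C (proj₁ (adjFaces e)) ∧ insideᵇ C (proj₂ (adjFaces e)))

-- Orientations: σ e = true means e is oriented base → head.

Orientation : Set
Orientation = Edge → Bool

tailOf : Orientation → Edge → Vertex
tailOf σ e = if' σ e then base e else head e
  where
  if'_then_else_ : Bool → Vertex → Vertex → Vertex
  if' true then a else b = a
  if' false then a else b = b

headOf : Orientation → Edge → Vertex
headOf σ e = tailOf (λ x → not (σ x)) e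

outdeg indeg : List Vertex → Orientation → Vertex → ℕ
outdeg C σ v = length (filter (λ e → T? (inGᵇ C e ∧ (tailOf σ e ==ᵥ v))) (incident v))
  where open import Data.Bool.Properties using () renaming (T? to T?)
indeg C σ v = length (filter (λ e → T? (inGᵇ C e ∧ (headOf σ e ==ᵥ v))) (incident v))
  where open import Data.Bool.Properties using () renaming (T? to T?)

Eulerian : List Vertex → Orientation → Set
Eulerian C σ = ∀ (v : Vertex) → outdeg C σ v ≡ indeg C σ v

-- Directed / almost-directed faces.  Boundary edges of a face listed in
-- counterclockwise order, with a flag: true iff traversing the face
-- counterclockwise runs along the edge base → head.

boundary : Face → (Edge × Bool) × (Edge × Bool) × (Edge × Bool)
boundary (i , j , up) =
  ((i , j , hor) , true) , ((i , j ℤ.+ 1ℤ , dia) , false) , ((i , j , ver) , false)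
boundary (i , j , down) =
  ((i ℤ.+ 1ℤ , j , ver) , true) , ((i , j ℤ.+ 1ℤ , hor) , false) , ((i , j ℤ.+ 1ℤ , dia) , true)

ccw : Orientation → Edge × Bool → Bool
ccw σ (e , s) = not (σ e xor s)

_==ᵇ_ : Bool → Bool → Bool
a ==ᵇ b = not (a xor b)

onBoundary : Face → Edge → Bool
onBoundary F e with boundary F
... | (a , _) , (b , _) , (c , _) = (e ==ₑ a) ∨ ((e ==ₑ b) ∨ (e ==ₑ c))

Directed : Orientation → Face → Set
Directed σ F with boundary F
... | a , b , c = T ((ccw σ a ==ᵇ ccw σ b) ∧ (ccw σ b ==ᵇ ccw σ c))

AlmostDirectedBlocking : Orientation → Face → Edge → Set
AlmostDirectedBlocking σ F e with boundary F
... | a , b , c =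
  T (  ((e ==ₑ proj₁ a) ∧ ((ccw σ b ==ᵇ ccw σ c) ∧ not (ccw σ a ==ᵇ ccw σ b)))
     ∨ (((e ==ₑ proj₁ b) ∧ ((ccw σ a ==ᵇ ccw σ c) ∧ not (ccw σ b ==ᵇ ccw σ a)))
     ∨  ((e ==ₑ proj₁ c) ∧ ((ccw σ a ==ᵇ ccw σ b) ∧ not (ccw σ c ==ᵇ ccw σ a)))))

IsTower : List Vertex → Orientation → List Face → Set
IsTower C σ [] = ⊥
IsTower C σ (F ∷ []) = Inside C F × Directed σ F
IsTower C σ (F ∷ F' ∷ rest) =
  Inside C F
  × ¬ (F ≡ F')
  × Σ Edge (λ e → T (onBoundary F e) × T (onBoundary F' e) × AlmostDirectedBlocking σ F e)
  × IsTower C σ (F' ∷ rest)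

{-# OPTIONS --safe #-}
-- An Eulerian orientation has a height function on faces which changes by ±1 across every edge of
-- G(C), the sign given by the direction of the edge; here it is the signed number of edges of G(C)
-- crossed by a horizontal ray from the face, and the in/out balance at the vertices makes it
-- consistent across horizontal edges as well. In a tower every crossed (blocking) edge runs the same
-- way around its face, so the height moves monotonically and the two ends of a tower of length h
-- differ in height by h - 1. Conversely, each edge crossed by the ray of a face borders an inside
-- face of that row, so a face of height m sees at least m/3 inside faces to its right. The height
-- drops by at most 2 per row going up, so each of the n = ⌊m/3⌋ rows above still has height at
-- least n, and f ≥ n²/3. As h ≤ 2m + O(1), this gives h² = O(f).
module Submission where

open import Defs
open import Data.Bool using (Bool; true; false; _∧_; _∨_; not; _xor_; T)
open import Data.Bool.Properties using (T?; T-∧; T-∨; T-≡; ∨-comm; ∨-zeroʳ; ∨-identityʳ; ∧-zeroʳ; ∧-identityʳ; not-involutive; not-¬)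
open import Data.Bool.ListAction using (any)
open import Data.Nat as ℕ using (ℕ; zero; suc; z≤n; s≤s; _+_; _<_; _≤_; _*_)
import Data.Nat.Properties as ℕₚ
open import Data.Nat.DivMod using (_/_; _%_; m/n*n≤m; m≡m%n+[m/n]*n; m%n<n)
import Data.Nat.Tactic.RingSolver as ℕ-Ring
open import Data.Integer as ℤ using (ℤ; +_; 0ℤ; ∣_∣)
import Data.Integer.Properties as ℤₚ
open import Data.Integer.Tactic.RingSolver using (solve-∀)
open import Data.List using (List; []; _∷_; length; filter; foldr; _++_; drop)
open import Data.List.Properties using (length-++; filter-++)
open import Data.List.Relation.Unary.Any using (here; there)
open import Data.List.Relation.Unary.Any.Properties using (any⁺; any⁻)
open import Data.List.Relation.Unary.All as All using (All; _∷_)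
open import Data.List.Relation.Unary.AllPairs using ([]; _∷_)
open import Data.List.Relation.Unary.Unique.Propositional using (Unique)
open import Data.List.Relation.Unary.Unique.Propositional.Properties as Uniqueₚ using (Unique[x∷xs]⇒x∉xs)
open import Data.List.Membership.Propositional using (_∈_; _∉_; find; lose)
open import Data.List.Membership.Propositional.Properties using (∈-filter⁺; ∈-filter⁻; ∈-++⁻; ∈-length)
open import Data.Product using (Σ; _×_; _,_; proj₁; proj₂)
open import Data.Sum using (_⊎_; inj₁; inj₂)
open import Data.Empty using (⊥; ⊥-elim)
open import Data.Unit using (tt)
open import Function using (_∘_)
open import Function.Bundles using (_⇔_; Equivalence)
open import Relation.Nullary using (¬_; yes; no)
open import Relation.Nullary.Decidable using (dec-true; dec-false)
open import Relation.Binary.PropositionalEquality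

toℕ : Bool → ℕ
toℕ true  = 1
toℕ false = 0

T-∧ˡ : ∀ {a b} → T (a ∧ b) → T a
T-∧ˡ {a} {b} t = proj₁ (Equivalence.to (T-∧ {a} {b}) t)

T-∧ʳ : ∀ {a b} → T (a ∧ b) → T b
T-∧ʳ {a} {b} t = proj₂ (Equivalence.to (T-∧ {a} {b}) t)

T-∨⁻ : ∀ {a b} → T (a ∨ b) → T a ⊎ T b
T-∨⁻ {a} {b} = Equivalence.to (T-∨ {a} {b})

T⇒≡true : ∀ {b} → T b → b ≡ true
T⇒≡true {b} = Equivalence.to (T-≡ {b})

¬T⇒≡false : ∀ {b} → ¬ T b → b ≡ false
¬T⇒≡false {false} _ = refl
¬T⇒≡false {true}  p = ⊥-elim (p tt)

Bool-ext : ∀ {a b} → (T a → T b) → (T b → T a) → a ≡ b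
Bool-ext {true}  {true}  _ _ = refl
Bool-ext {false} {false} _ _ = refl
Bool-ext {true}  {false} f _ = ⊥-elim (f tt)
Bool-ext {false} {true}  _ g = ⊥-elim (g tt)

count : {A : Set} → (A → Bool) → List A → ℕ
count p xs = length (filter (λ x → T? (p x)) xs)

module _ {A : Set} (p : A → Bool) where

  count-∷ : ∀ x xs → count p (x ∷ xs) ≡ toℕ (p x) + count p xs
  count-∷ x xs with p x
  ... | true  = refl
  ... | false = refl

  count-++ : ∀ xs ys → count p (xs ++ ys) ≡ count p xs + count p ys
  count-++ xs ys = trans (cong length (filter-++ (λ x → T? (p x)) xs ys))
                         (length-++ (filter (λ x → T? (p x)) xs))

  count≡0 : ∀ xs → (∀ {x} → x ∈ xs → ¬ T (p x)) → count p xs ≡ 0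
  count≡0 []       _    = refl
  count≡0 (x ∷ xs) none = trans (count-∷ x xs)
    (cong₂ _+_ (cong toℕ (¬T⇒≡false (none (here refl)))) (count≡0 xs (none ∘ there)))

  count≥1 : ∀ xs → T (any p xs) → 1 ≤ count p xs
  count≥1 xs t with find (any⁻ p xs t)
  ... | x , x∈xs , px = ∈-length (∈-filter⁺ (λ x → T? (p x)) x∈xs px)

  count≤1-∷ : ∀ x xs → (T (p x) → ∀ {y} → y ∈ xs → ¬ T (p y)) →
              count p xs ≤ 1 → count p (x ∷ xs) ≤ 1
  count≤1-∷ x xs excl ≤1 rewrite count-∷ x xs with p x
  ... | true  = ℕₚ.≤-reflexive (cong suc (count≡0 xs (excl tt)))
  ... | false = ≤1

count-∨ : ∀ {A : Set} (p q r : A → Bool) → (∀ x → p x ≡ q x ∨ r x) →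
          ∀ xs → (∀ {x} → x ∈ xs → T (q x) → ¬ T (r x)) →
          count p xs ≡ count q xs + count r xs
count-∨ p q r p≡q∨r []       _    = refl
count-∨ p q r p≡q∨r (x ∷ xs) excl
  rewrite count-∷ p x xs | count-∷ q x xs | count-∷ r x xs | p≡q∨r x
        | count-∨ p q r p≡q∨r xs (excl ∘ there)
  with q x | r x | excl (here refl)
... | true  | true  | e = ⊥-elim (e tt tt)
... | true  | false | _ = refl
... | false | true  | _ = sym (ℕₚ.+-suc _ _)
... | false | false | _ = refl

count-difference : ∀ {A : Set} (p q : A → Bool) xs →
  + count p xs ℤ.- + count q xs ≡ foldr (λ x acc → (+ toℕ (p x) ℤ.- + toℕ (q x)) ℤ.+ acc) 0ℤ xs
count-difference p q []       = refl
count-difference p q (x ∷ xs) rewrite count-∷ p x xs | count-∷ q x xs =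
  trans (cong₂ ℤ._-_ (ℤₚ.pos-+ (toℕ (p x)) (count p xs)) (ℤₚ.pos-+ (toℕ (q x)) (count q xs)))
  (trans (regroup (+ toℕ (p x)) (+ count p xs) (+ toℕ (q x)) (+ count q xs))
         (cong (λ z → (+ toℕ (p x) ℤ.- + toℕ (q x)) ℤ.+ z) (count-difference p q xs)))
  where
  regroup : ∀ a b c d → (a ℤ.+ b) ℤ.- (c ℤ.+ d) ≡ (a ℤ.- c) ℤ.+ (b ℤ.- d)
  regroup = solve-∀

remove : ∀ {A : Set} {x : A} ys → x ∈ ys →
         Σ (List A) λ zs → length ys ≡ suc (length zs) × (∀ {y} → y ∈ ys → y ≢ x → y ∈ zs)
remove (y ∷ ys) (here refl)  = ys , refl , λ { (here refl) y≢y → ⊥-elim (y≢y refl) ; (there m) _ → m }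
remove (y ∷ ys) (there x∈ys) with remove ys x∈ys
... | zs , eq , keep = y ∷ zs , cong suc eq , λ { (here refl) _ → here refl ; (there m) ne → there (keep m ne) }

length-mono-⊆ : ∀ {A : Set} (xs ys : List A) → Unique xs → (∀ {x} → x ∈ xs → x ∈ ys) →
                length xs ≤ length ys
length-mono-⊆ []       ys _            _     = z≤n
length-mono-⊆ (x ∷ xs) ys (x∉xs ∷ uxs) xs⊆ys with remove ys (xs⊆ys (here refl))
... | zs , |ys|≡ , keep = subst (suc (length xs) ≤_) (sym |ys|≡)
  (s≤s (length-mono-⊆ xs zs uxs (λ m → keep (xs⊆ys (there m)) (λ y≡x → All.lookup x∉xs m (sym y≡x)))))

∑ℕ : ℕ → (ℕ → ℕ) → ℕ
∑ℕ zero    f = 0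
∑ℕ (suc n) f = f 0 + ∑ℕ n (f ∘ suc)

∑ℤ : ℕ → (ℕ → ℤ) → ℤ
∑ℤ zero    f = 0ℤ
∑ℤ (suc n) f = f 0 ℤ.+ ∑ℤ n (f ∘ suc)

count≤length : ∀ {A : Set} (p : A → Bool) {xs ys : List A} → Unique xs →
               (∀ {x} → x ∈ xs → T (p x) → x ∈ ys) → count p xs ≤ length ys
count≤length p {xs} {ys} uxs sub =
  length-mono-⊆ (filter (λ x → T? (p x)) xs) ys (Uniqueₚ.filter⁺ (λ x → T? (p x)) uxs)
    (λ x∈ → let x∈xs , px = ∈-filter⁻ (λ x → T? (p x)) {xs = xs} x∈ in sub x∈xs px)

∑ℕ-cong : ∀ n {f g : ℕ → ℕ} → (∀ s → f s ≡ g s) → ∑ℕ n f ≡ ∑ℕ n g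
∑ℕ-cong zero    _  = refl
∑ℕ-cong (suc n) eq = cong₂ _+_ (eq 0) (∑ℕ-cong n (eq ∘ suc))

∑ℕ-mono : ∀ n {f g : ℕ → ℕ} → (∀ s → s < n → f s ≤ g s) → ∑ℕ n f ≤ ∑ℕ n g
∑ℕ-mono zero    _  = z≤n
∑ℕ-mono (suc n) le = ℕₚ.+-mono-≤ (le 0 (s≤s z≤n)) (∑ℕ-mono n (λ s s<n → le (suc s) (s≤s s<n)))

∑ℕ-+ : ∀ n (f g : ℕ → ℕ) → ∑ℕ n (λ s → f s + g s) ≡ ∑ℕ n f + ∑ℕ n g
∑ℕ-+ zero    f g = refl
∑ℕ-+ (suc n) f g rewrite ∑ℕ-+ n (f ∘ suc) (g ∘ suc) = interchange (f 0) (g 0) _ _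
  where
  interchange : ∀ a b c d → a + b + (c + d) ≡ a + c + (b + d)
  interchange = ℕ-Ring.solve-∀

∑ℕ-const : ∀ n c → ∑ℕ n (λ _ → c) ≡ n * c
∑ℕ-const zero    c = refl
∑ℕ-const (suc n) c = cong (λ z → c + z) (∑ℕ-const n c)

∑ℕ-*ˡ : ∀ n k (f : ℕ → ℕ) → ∑ℕ n (λ s → k * f s) ≡ k * ∑ℕ n f
∑ℕ-*ˡ zero    k f = sym (ℕₚ.*-zeroʳ k)
∑ℕ-*ˡ (suc n) k f rewrite ∑ℕ-*ˡ n k (f ∘ suc) = sym (ℕₚ.*-distribˡ-+ k (f 0) _)

∑ℕ≤∑ℕ-suc : ∀ n (f : ℕ → ℕ) → ∑ℕ n f ≤ ∑ℕ (suc n) f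
∑ℕ≤∑ℕ-suc zero    f = z≤n
∑ℕ≤∑ℕ-suc (suc n) f = ℕₚ.+-monoʳ-≤ (f 0) (∑ℕ≤∑ℕ-suc n (f ∘ suc))

∑ℕ-tail≤ : ∀ n (f : ℕ → ℕ) → ∑ℕ n (f ∘ suc) ≤ ∑ℕ (suc n) f
∑ℕ-tail≤ n f = ℕₚ.m≤n+m _ (f 0)

∣∑ℤ∣≤∑ℕ∣∣ : ∀ n (f : ℕ → ℤ) → ∣ ∑ℤ n f ∣ ≤ ∑ℕ n (λ s → ∣ f s ∣)
∣∑ℤ∣≤∑ℕ∣∣ zero    f = z≤n
∣∑ℤ∣≤∑ℕ∣∣ (suc n) f =
  ℕₚ.≤-trans (ℤₚ.∣i+j∣≤∣i∣+∣j∣ (f 0) _) (ℕₚ.+-monoʳ-≤ ∣ f 0 ∣ (∣∑ℤ∣≤∑ℕ∣∣ n (f ∘ suc)))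

∑ℤ-cong : ∀ n {f g : ℕ → ℤ} → (∀ s → f s ≡ g s) → ∑ℤ n f ≡ ∑ℤ n g
∑ℤ-cong zero    _  = refl
∑ℤ-cong (suc n) eq = cong₂ ℤ._+_ (eq 0) (∑ℤ-cong n (eq ∘ suc))

∑ℤ-suc : ∀ n (f : ℕ → ℤ) → ∑ℤ (suc n) f ≡ ∑ℤ n f ℤ.+ f n
∑ℤ-suc zero    f = trans (ℤₚ.+-identityʳ (f 0)) (sym (ℤₚ.+-identityˡ (f 0)))
∑ℤ-suc (suc n) f rewrite ∑ℤ-suc n (f ∘ suc) = sym (ℤₚ.+-assoc (f 0) _ _)

∑ℤ-zero : ∀ n {f : ℕ → ℤ} → (∀ s → f s ≡ 0ℤ) → ∑ℤ n f ≡ 0ℤ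
∑ℤ-zero zero    _    = refl
∑ℤ-zero (suc n) f≡0 rewrite f≡0 0 = trans (ℤₚ.+-identityˡ _) (∑ℤ-zero n (f≡0 ∘ suc))

∑ℤ-+ : ∀ n (f g : ℕ → ℤ) → ∑ℤ n (λ s → f s ℤ.+ g s) ≡ ∑ℤ n f ℤ.+ ∑ℤ n g
∑ℤ-+ zero    f g = refl
∑ℤ-+ (suc n) f g rewrite ∑ℤ-+ n (f ∘ suc) (g ∘ suc) = interchange (f 0) (g 0) _ _
  where
  interchange : ∀ a b c d → (a ℤ.+ b) ℤ.+ (c ℤ.+ d) ≡ (a ℤ.+ c) ℤ.+ (b ℤ.+ d)
  interchange = solve-∀

∑ℤ-minus : ∀ n (f g : ℕ → ℤ) → ∑ℤ n (λ s → f s ℤ.- g s) ≡ ∑ℤ n f ℤ.- ∑ℤ n g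
∑ℤ-minus zero    f g = refl
∑ℤ-minus (suc n) f g rewrite ∑ℤ-minus n (f ∘ suc) (g ∘ suc) = interchange (f 0) (g 0) _ _
  where
  interchange : ∀ a b c d → (a ℤ.- b) ℤ.+ (c ℤ.- d) ≡ (a ℤ.+ c) ℤ.- (b ℤ.+ d)
  interchange = solve-∀

i+[1+n]≡i+1+n : ∀ i n → i ℤ.+ + suc n ≡ (i ℤ.+ 1ℤ) ℤ.+ + n
i+[1+n]≡i+1+n i n = trans (cong (λ z → i ℤ.+ z) (ℤₚ.pos-+ 1 n)) (sym (ℤₚ.+-assoc i 1ℤ (+ n)))

∑ℤ-six : ∀ n (a b c d e f : ℕ → ℤ) →
  ∑ℤ n (λ s → (a s ℤ.+ b s ℤ.+ c s) ℤ.- (d s ℤ.+ e s ℤ.+ f s)) ≡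
  (∑ℤ n a ℤ.+ ∑ℤ n b ℤ.+ ∑ℤ n c) ℤ.- (∑ℤ n d ℤ.+ ∑ℤ n e ℤ.+ ∑ℤ n f)
∑ℤ-six n a b c d e f = trans (∑ℤ-minus n (λ s → a s ℤ.+ b s ℤ.+ c s) (λ s → d s ℤ.+ e s ℤ.+ f s))
  (cong₂ ℤ._-_ (trans (∑ℤ-+ n (λ s → a s ℤ.+ b s) c) (cong (ℤ._+ ∑ℤ n c) (∑ℤ-+ n a b)))
               (trans (∑ℤ-+ n (λ s → d s ℤ.+ e s) f) (cong (ℤ._+ ∑ℤ n f) (∑ℤ-+ n d e))))

i+1-1≡i : ∀ i → (i ℤ.+ 1ℤ) ℤ.- 1ℤ ≡ i
i+1-1≡i = solve-∀

i-1+1≡i : ∀ i → (i ℤ.- 1ℤ) ℤ.+ 1ℤ ≡ i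
i-1+1≡i = solve-∀

1+[i-1]≡i : ∀ i → 1ℤ ℤ.+ (i ℤ.- 1ℤ) ≡ i
1+[i-1]≡i = solve-∀

i<i+1 : ∀ i → i ℤ.< i ℤ.+ 1ℤ
i<i+1 i = ℤₚ.suc[i]≤j⇒i<j (ℤₚ.≤-reflexive (ℤₚ.+-comm 1ℤ i))

i-1<i : ∀ i → i ℤ.- 1ℤ ℤ.< i
i-1<i i = subst (i ℤ.- 1ℤ ℤ.<_) (i-1+1≡i i) (i<i+1 (i ℤ.- 1ℤ))

i+1≢i : ∀ i → i ℤ.+ 1ℤ ≢ i
i+1≢i i eq = ℤₚ.<-irrefl (sym eq) (i<i+1 i)

i-1≢i : ∀ i → i ℤ.- 1ℤ ≢ i
i-1≢i i eq = i+1≢i (i ℤ.- 1ℤ) (trans (i-1+1≡i i) (sym eq))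

i+2≢i : ∀ i → (i ℤ.+ 1ℤ) ℤ.+ 1ℤ ≢ i
i+2≢i i eq = ℤₚ.<-irrefl (sym eq) (ℤₚ.<-trans (i<i+1 i) (i<i+1 (i ℤ.+ 1ℤ)))

==ℤ⇒≡ : ∀ {a b} → T (a ==ℤ b) → a ≡ b
==ℤ⇒≡ {a} {b} t with a ℤ.≟ b
... | yes a≡b = a≡b

==ℤ-≢ : ∀ {a b} → a ≢ b → (a ==ℤ b) ≡ false
==ℤ-≢ {a} {b} = dec-false (a ℤ.≟ b)

==ℤ-refl : ∀ a → (a ==ℤ a) ≡ true
==ℤ-refl a = dec-true (a ℤ.≟ a) refl

<ℤ⇒< : ∀ {a b} → T (a <ℤ b) → a ℤ.< b
<ℤ⇒< {a} {b} t with a ℤ.<? b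
... | yes a<b = a<b

≤ℤ⇒≤ : ∀ {a b} → T (a ≤ℤ b) → a ℤ.≤ b
≤ℤ⇒≤ {a} {b} t with a ℤ.≤? b
... | yes a≤b = a≤b

==ᵥ⇒≡ : ∀ {u w : Vertex} → T (u ==ᵥ w) → u ≡ w
==ᵥ⇒≡ {a , b} {c , d} t = cong₂ _,_ (==ℤ⇒≡ (T-∧ˡ t)) (==ℤ⇒≡ (T-∧ʳ {a ==ℤ c} t))

==ᵥ-refl : ∀ v → (v ==ᵥ v) ≡ true
==ᵥ-refl (a , b) rewrite ==ℤ-refl a | ==ℤ-refl b = refl

==ᵥ-≢ : ∀ {u w : Vertex} → u ≢ w → (u ==ᵥ w) ≡ false
==ᵥ-≢ {a , b} {c , d} u≢w with a ℤ.≟ c | b ℤ.≟ d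
... | yes refl | yes refl = ⊥-elim (u≢w refl)
... | yes _    | no _     = refl
... | no _     | _        = refl

==ᴰ⇒≡ : ∀ {d d'} → T (d ==ᴰ d') → d ≡ d'
==ᴰ⇒≡ {hor} {hor} _ = refl
==ᴰ⇒≡ {ver} {ver} _ = refl
==ᴰ⇒≡ {dia} {dia} _ = refl

==ₑ⇒≡ : ∀ {e f : Edge} → T (e ==ₑ f) → e ≡ f
==ₑ⇒≡ {a , b , d} {c , e , d'} t
  with ==ℤ⇒≡ {a} {c} (T-∧ˡ t) | ==ℤ⇒≡ {b} {e} (T-∧ˡ (T-∧ʳ {a ==ℤ c} t))
     | ==ᴰ⇒≡ {d} {d'} (T-∧ʳ {b ==ℤ e} (T-∧ʳ {a ==ℤ c} t))
... | refl | refl | refl = refl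

==ₑ-refl : ∀ e → (e ==ₑ e) ≡ true
==ₑ-refl (a , b , hor) rewrite ==ℤ-refl a | ==ℤ-refl b = refl
==ₑ-refl (a , b , ver) rewrite ==ℤ-refl a | ==ℤ-refl b = refl
==ₑ-refl (a , b , dia) rewrite ==ℤ-refl a | ==ℤ-refl b = refl

joins-ends : ∀ e {u w} → T (joins e u w) → (base e ≡ u × head e ≡ w) ⊎ (base e ≡ w × head e ≡ u)
joins-ends e {u} {w} t with T-∨⁻ {(base e ==ᵥ u) ∧ (head e ==ᵥ w)} t
... | inj₁ t₁ = inj₁ (==ᵥ⇒≡ (T-∧ˡ t₁) , ==ᵥ⇒≡ (T-∧ʳ {base e ==ᵥ u} t₁))
... | inj₂ t₂ = inj₂ (==ᵥ⇒≡ (T-∧ˡ t₂) , ==ᵥ⇒≡ (T-∧ʳ {base e ==ᵥ w} t₂))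

joins-sym : ∀ e u w → joins e w u ≡ joins e u w
joins-sym e u w = ∨-comm ((base e ==ᵥ w) ∧ (head e ==ᵥ u)) ((base e ==ᵥ u) ∧ (head e ==ᵥ w))

endpoints-injective : ∀ (e e' : Edge) → base e ≡ base e' → head e ≡ head e' → e ≡ e'
endpoints-injective (k , l , hor) (.k , .l , hor) refl _ = refl
endpoints-injective (k , l , ver) (.k , .l , ver) refl _ = refl
endpoints-injective (k , l , dia) (.k , .l , dia) refl _ = refl
endpoints-injective (k , l , hor) (.k , .l , ver) refl q = ⊥-elim (i+1≢i k (cong proj₁ q))
endpoints-injective (k , l , ver) (.k , .l , hor) refl q = ⊥-elim (i+1≢i k (sym (cong proj₁ q)))
endpoints-injective (k , l , hor) (.k , .l , dia) refl q = ⊥-elim (i-1≢i l (sym (cong proj₂ q)))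
endpoints-injective (k , l , dia) (.k , .l , hor) refl q = ⊥-elim (i-1≢i l (cong proj₂ q))
endpoints-injective (k , l , ver) (.k , .l , dia) refl q = ⊥-elim (i+1≢i k (sym (cong proj₁ q)))
endpoints-injective (k , l , dia) (.k , .l , ver) refl q = ⊥-elim (i+1≢i k (cong proj₁ q))

-- The edge directions (1,0), (0,1), (1,-1) lie in an open half-plane, so no two of them cancel.
endpoints-not-swapped : ∀ (e e' : Edge) → base e ≡ head e' → head e ≡ base e' → ⊥
endpoints-not-swapped (._ , ._ , hor) (k , l , hor) refl q = i+2≢i k (cong proj₁ q)
endpoints-not-swapped (._ , ._ , ver) (k , l , hor) refl q = i+1≢i k (cong proj₁ q)
endpoints-not-swapped (._ , ._ , dia) (k , l , hor) refl q = i+2≢i k (cong proj₁ q)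
endpoints-not-swapped (._ , ._ , hor) (k , l , ver) refl q = i+1≢i k (cong proj₁ q)
endpoints-not-swapped (._ , ._ , ver) (k , l , ver) refl q = i+2≢i l (cong proj₂ q)
endpoints-not-swapped (._ , ._ , dia) (k , l , ver) refl q = i+1≢i k (cong proj₁ q)
endpoints-not-swapped (._ , ._ , hor) (k , l , dia) refl q = i+2≢i k (cong proj₁ q)
endpoints-not-swapped (._ , ._ , ver) (k , l , dia) refl q = i+1≢i k (cong proj₁ q)
endpoints-not-swapped (._ , ._ , dia) (k , l , dia) refl q = i+2≢i k (cong proj₁ q)

joins-unique : ∀ e e' {u w} → T (joins e u w) → T (joins e' u w) → e ≡ e'
joins-unique e e' t t' with joins-ends e t | joins-ends e' t'
... | inj₁ (p , q) | inj₁ (p' , q') = endpoints-injective e e' (trans p (sym p')) (trans q (sym q'))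
... | inj₂ (p , q) | inj₂ (p' , q') = endpoints-injective e e' (trans p (sym p')) (trans q (sym q'))
... | inj₁ (p , q) | inj₂ (p' , q') = ⊥-elim (endpoints-not-swapped e e' (trans p (sym q')) (trans q (sym p')))
... | inj₂ (p , q) | inj₁ (p' , q') = ⊥-elim (endpoints-not-swapped e e' (trans p (sym q')) (trans q (sym p')))

∈-incident-base : ∀ e → e ∈ incident (base e)
∈-incident-base (k , l , hor) = here refl
∈-incident-base (k , l , ver) = there (there (here refl))
∈-incident-base (k , l , dia) = there (there (there (there (here refl))))

∈-incident-head : ∀ e → e ∈ incident (head e)
∈-incident-head (k , l , hor) =
  subst (λ z → z ∈ incident (k ℤ.+ 1ℤ , l)) (cong (λ z → z , l , hor) (i+1-1≡i k))
    (there (here refl))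
∈-incident-head (k , l , ver) =
  subst (λ z → z ∈ incident (k , l ℤ.+ 1ℤ)) (cong (λ z → k , z , ver) (i+1-1≡i l))
    (there (there (there (here refl))))
∈-incident-head (k , l , dia) =
  subst (λ z → z ∈ incident (k ℤ.+ 1ℤ , l ℤ.- 1ℤ)) (cong₂ (λ z z' → z , z' , dia) (i+1-1≡i k) (i-1+1≡i l))
    (there (there (there (there (there (here refl))))))

joins⇒∈incident : ∀ e {u w} → T (joins e u w) → e ∈ incident u
joins⇒∈incident e t with joins-ends e t
... | inj₁ (refl , _) = ∈-incident-base e
... | inj₂ (_ , refl) = ∈-incident-head e

any-incident-joins : ∀ e u w → any (λ e' → joins e' u w ∧ (e' ==ₑ e)) (incident u) ≡ joins e u w
any-incident-joins e u w = Bool-ext ⇒ ⇐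
  where
  ⇒ : T (any (λ e' → joins e' u w ∧ (e' ==ₑ e)) (incident u)) → T (joins e u w)
  ⇒ t with find (any⁻ (λ e' → joins e' u w ∧ (e' ==ₑ e)) (incident u) t)
  ... | e' , _ , t' with ==ₑ⇒≡ {e'} {e} (T-∧ʳ {joins e' u w} t')
  ... | refl = T-∧ˡ t'
  ⇐ : T (joins e u w) → T (any (λ e' → joins e' u w ∧ (e' ==ₑ e)) (incident u))
  ⇐ t = any⁺ (λ e' → joins e' u w ∧ (e' ==ₑ e)) (lose {P = λ e' → T (joins e' u w ∧ (e' ==ₑ e))}
          (joins⇒∈incident e t) (subst T (sym (trans (cong (joins e u w ∧_) (==ₑ-refl e)) (∧-identityʳ _))) t))

data Side : Set where
  s₁ s₂ s₃ : Side

side : Face → Side → Edge × Bool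
side F s₁ = proj₁ (boundary F)
side F s₂ = proj₁ (proj₂ (boundary F))
side F s₃ = proj₂ (proj₂ (boundary F))

edgeAt : Face → Side → Edge
edgeAt F s = proj₁ (side F s)

ccwAt : Orientation → Face → Side → Bool
ccwAt σ F s = ccw σ (side F s)

neighbour : Face → Side → Face
neighbour (i , j , up)   s₁ = i , j ℤ.- 1ℤ , down
neighbour (i , j , up)   s₂ = i , j , down
neighbour (i , j , up)   s₃ = i ℤ.- 1ℤ , j , down
neighbour (i , j , down) s₁ = i ℤ.+ 1ℤ , j , up
neighbour (i , j , down) s₂ = i , j ℤ.+ 1ℤ , up
neighbour (i , j , down) s₃ = i , j , up

-- The index of the shared edge among the sides of neighbour F s.
mirror : Face → Side → Side
mirror (_ , _ , up)   s₁ = s₂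
mirror (_ , _ , up)   s₂ = s₃
mirror (_ , _ , up)   s₃ = s₁
mirror (_ , _ , down) s₁ = s₃
mirror (_ , _ , down) s₂ = s₁
mirror (_ , _ , down) s₃ = s₂

edgeAt-neighbour : ∀ F s → edgeAt (neighbour F s) (mirror F s) ≡ edgeAt F s
edgeAt-neighbour (i , j , up)   s₁ = cong (λ z → i , z , hor) (i-1+1≡i j)
edgeAt-neighbour (i , j , up)   s₂ = refl
edgeAt-neighbour (i , j , up)   s₃ = cong (λ z → z , j , ver) (i-1+1≡i i)
edgeAt-neighbour (i , j , down) s₁ = refl
edgeAt-neighbour (i , j , down) s₂ = refl
edgeAt-neighbour (i , j , down) s₃ = refl

flag-neighbour : ∀ F s → proj₂ (side (neighbour F s) (mirror F s)) ≡ not (proj₂ (side F s))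
flag-neighbour (_ , _ , up)   s₁ = refl
flag-neighbour (_ , _ , up)   s₂ = refl
flag-neighbour (_ , _ , up)   s₃ = refl
flag-neighbour (_ , _ , down) s₁ = refl
flag-neighbour (_ , _ , down) s₂ = refl
flag-neighbour (_ , _ , down) s₃ = refl

ccwAt-neighbour : ∀ σ F s → ccwAt σ (neighbour F s) (mirror F s) ≡ not (ccwAt σ F s)
ccwAt-neighbour σ F s =
  trans (cong₂ (λ e b → not (σ e xor b)) (edgeAt-neighbour F s) (flag-neighbour F s))
        (cong not (xor-not (σ (edgeAt F s)) (proj₂ (side F s))))
  where
  xor-not : ∀ x y → (x xor not y) ≡ not (x xor y)
  xor-not true  _ = refl
  xor-not false _ = refl

neighbour-involutive : ∀ F s → neighbour (neighbour F s) (mirror F s) ≡ F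
neighbour-involutive (i , j , up)   s₁ = cong (λ z → i , z , up) (i-1+1≡i j)
neighbour-involutive (i , j , up)   s₂ = refl
neighbour-involutive (i , j , up)   s₃ = cong (λ z → z , j , up) (i-1+1≡i i)
neighbour-involutive (i , j , down) s₁ = cong (λ z → z , j , down) (i+1-1≡i i)
neighbour-involutive (i , j , down) s₂ = cong (λ z → i , z , down) (i+1-1≡i j)
neighbour-involutive (i , j , down) s₃ = refl

mirror-involutive : ∀ F s → mirror (neighbour F s) (mirror F s) ≡ s
mirror-involutive (_ , _ , up)   s₁ = refl
mirror-involutive (_ , _ , up)   s₂ = refl
mirror-involutive (_ , _ , up)   s₃ = refl
mirror-involutive (_ , _ , down) s₁ = refl
mirror-involutive (_ , _ , down) s₂ = refl
mirror-involutive (_ , _ , down) s₃ = refl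

adjFaces-edgeAt : ∀ F s → adjFaces (edgeAt F s) ≡ (F , neighbour F s) ⊎ adjFaces (edgeAt F s) ≡ (neighbour F s , F)
adjFaces-edgeAt (i , j , up)   s₁ = inj₁ refl
adjFaces-edgeAt (i , j , up)   s₂ = inj₁ (cong (λ z → (i , z , up) , (i , z , down)) (i+1-1≡i j))
adjFaces-edgeAt (i , j , up)   s₃ = inj₁ refl
adjFaces-edgeAt (i , j , down) s₁ = inj₂ (cong (λ z → (i ℤ.+ 1ℤ , j , up) , (z , j , down)) (i+1-1≡i i))
adjFaces-edgeAt (i , j , down) s₂ = inj₂ (cong (λ z → (i , j ℤ.+ 1ℤ , up) , (i , z , down)) (i+1-1≡i j))
adjFaces-edgeAt (i , j , down) s₃ = inj₂ (cong (λ z → (i , z , up) , (i , z , down)) (i+1-1≡i j))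

onBoundary⇒edgeAt : ∀ F e → T (onBoundary F e) → Σ Side λ s → e ≡ edgeAt F s
onBoundary⇒edgeAt (i , j , up) e t with T-∨⁻ {e ==ₑ (i , j , hor)} t
... | inj₁ t₁ = s₁ , ==ₑ⇒≡ t₁
... | inj₂ t₂ with T-∨⁻ {e ==ₑ (i , j ℤ.+ 1ℤ , dia)} t₂
...   | inj₁ t₃ = s₂ , ==ₑ⇒≡ t₃
...   | inj₂ t₄ = s₃ , ==ₑ⇒≡ t₄
onBoundary⇒edgeAt (i , j , down) e t with T-∨⁻ {e ==ₑ (i ℤ.+ 1ℤ , j , ver)} t
... | inj₁ t₁ = s₁ , ==ₑ⇒≡ t₁
... | inj₂ t₂ with T-∨⁻ {e ==ₑ (i , j ℤ.+ 1ℤ , hor)} t₂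
...   | inj₁ t₃ = s₂ , ==ₑ⇒≡ t₃
...   | inj₂ t₄ = s₃ , ==ₑ⇒≡ t₄

-- An edge borders exactly the two faces adjFaces e, so a second face on it is the neighbour.
shared-edge⇒neighbour : ∀ F s F' → T (onBoundary F' (edgeAt F s)) → F ≢ F' → F' ≡ neighbour F s
shared-edge⇒neighbour F s F' on F≢F' with onBoundary⇒edgeAt F' (edgeAt F s) on
... | s' , e≡
  with adjFaces-edgeAt F s
     | subst (λ e → adjFaces e ≡ (F' , neighbour F' s') ⊎ adjFaces e ≡ (neighbour F' s' , F'))
             (sym e≡) (adjFaces-edgeAt F' s')
... | inj₁ p | inj₁ q = ⊥-elim (F≢F' (cong proj₁ (trans (sym p) q)))
... | inj₁ p | inj₂ q = sym (cong proj₂ (trans (sym p) q))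
... | inj₂ p | inj₁ q = sym (cong proj₁ (trans (sym p) q))
... | inj₂ p | inj₂ q = ⊥-elim (F≢F' (cong proj₂ (trans (sym p) q)))

==ᵇ⇒≡ : ∀ {a b} → T (a ==ᵇ b) → a ≡ b
==ᵇ⇒≡ {true}  {true}  _ = refl
==ᵇ⇒≡ {false} {false} _ = refl

¬==ᵇ⇒≡not : ∀ {a b} → T (not (a ==ᵇ b)) → b ≡ not a
¬==ᵇ⇒≡not {true}  {false} _ = refl
¬==ᵇ⇒≡not {false} {true}  _ = refl

BlockingSide : Orientation → Face → Side → Set
BlockingSide σ F s = ∀ s' → s' ≡ s ⊎ ccwAt σ F s' ≡ not (ccwAt σ F s)

module _ (σ : Orientation) (F : Face) where
  private
    c : Side → Bool
    c = ccwAt σ F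

  uniform-ccw : T ((c s₁ ==ᵇ c s₂) ∧ (c s₂ ==ᵇ c s₃)) → ∀ s → c s ≡ c s₁
  uniform-ccw t s₁ = refl
  uniform-ccw t s₂ = sym (==ᵇ⇒≡ (T-∧ˡ t))
  uniform-ccw t s₃ = sym (trans (==ᵇ⇒≡ (T-∧ˡ t)) (==ᵇ⇒≡ (T-∧ʳ {c s₁ ==ᵇ c s₂} t)))

  private
    odd-one-out : ∀ s t u → (∀ s' → s' ≡ s ⊎ s' ≡ t ⊎ s' ≡ u) →
                  T ((c t ==ᵇ c u) ∧ not (c s ==ᵇ c t)) → BlockingSide σ F s
    odd-one-out s t u cover bc s' with cover s'
    ... | inj₁ s'≡s        = inj₁ s'≡s
    ... | inj₂ (inj₁ refl) = inj₂ (¬==ᵇ⇒≡not (T-∧ʳ {c t ==ᵇ c u} bc))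
    ... | inj₂ (inj₂ refl) = inj₂ (trans (sym (==ᵇ⇒≡ (T-∧ˡ bc))) (¬==ᵇ⇒≡not (T-∧ʳ {c t ==ᵇ c u} bc)))

  blocking-side : ∀ e →
    T (  ((e ==ₑ edgeAt F s₁) ∧ ((c s₂ ==ᵇ c s₃) ∧ not (c s₁ ==ᵇ c s₂)))
       ∨ (((e ==ₑ edgeAt F s₂) ∧ ((c s₁ ==ᵇ c s₃) ∧ not (c s₂ ==ᵇ c s₁)))
       ∨  ((e ==ₑ edgeAt F s₃) ∧ ((c s₁ ==ᵇ c s₂) ∧ not (c s₃ ==ᵇ c s₁))))) →
    Σ Side λ s → e ≡ edgeAt F s × BlockingSide σ F s
  blocking-side e t with T-∨⁻ {(e ==ₑ edgeAt F s₁) ∧ _} t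
  ... | inj₁ t₁ = s₁ , ==ₑ⇒≡ (T-∧ˡ t₁) ,
    odd-one-out s₁ s₂ s₃ (λ { s₁ → inj₁ refl ; s₂ → inj₂ (inj₁ refl) ; s₃ → inj₂ (inj₂ refl) })
      (T-∧ʳ {e ==ₑ edgeAt F s₁} t₁)
  ... | inj₂ t₂ with T-∨⁻ {(e ==ₑ edgeAt F s₂) ∧ _} t₂
  ...   | inj₁ t₃ = s₂ , ==ₑ⇒≡ (T-∧ˡ t₃) ,
    odd-one-out s₂ s₁ s₃ (λ { s₁ → inj₂ (inj₁ refl) ; s₂ → inj₁ refl ; s₃ → inj₂ (inj₂ refl) })
      (T-∧ʳ {e ==ₑ edgeAt F s₂} t₃)
  ...   | inj₂ t₄ = s₃ , ==ₑ⇒≡ (T-∧ˡ t₄) ,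
    odd-one-out s₃ s₁ s₂ (λ { s₁ → inj₂ (inj₁ refl) ; s₂ → inj₂ (inj₂ refl) ; s₃ → inj₁ refl })
      (T-∧ʳ {e ==ₑ edgeAt F s₃} t₄)

  private
    other : ∀ {s s' : Side} {X : Set} → s' ≡ s ⊎ X → s' ≢ s → X
    other (inj₁ s'≡s) s'≢s = ⊥-elim (s'≢s s'≡s)
    other (inj₂ x)    _    = x

    two-blocking-sides : ∀ s s' t → s' ≢ s → t ≢ s → t ≢ s' →
                         BlockingSide σ F s → BlockingSide σ F s' → ⊥
    two-blocking-sides s s' t s'≢s t≢s t≢s' B B' =
      no-three-way-split (c s) (c s') (c t) (other (B s') s'≢s) (other (B t) t≢s) (other (B' t) t≢s')
      where
      no-three-way-split : ∀ a b t → b ≡ not a → t ≡ not a → t ≡ not b → ⊥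
      no-three-way-split true  false false refl refl ()
      no-three-way-split false true  true  refl refl ()

  blockingSide-unique : ∀ {s s'} → BlockingSide σ F s → BlockingSide σ F s' → s ≡ s'
  blockingSide-unique {s₁} {s₁} _ _  = refl
  blockingSide-unique {s₂} {s₂} _ _  = refl
  blockingSide-unique {s₃} {s₃} _ _  = refl
  blockingSide-unique {s₁} {s₂} B B' = ⊥-elim (two-blocking-sides s₁ s₂ s₃ (λ ()) (λ ()) (λ ()) B B')
  blockingSide-unique {s₂} {s₁} B B' = ⊥-elim (two-blocking-sides s₂ s₁ s₃ (λ ()) (λ ()) (λ ()) B B')
  blockingSide-unique {s₁} {s₃} B B' = ⊥-elim (two-blocking-sides s₁ s₃ s₂ (λ ()) (λ ()) (λ ()) B B')
  blockingSide-unique {s₃} {s₁} B B' = ⊥-elim (two-blocking-sides s₃ s₁ s₂ (λ ()) (λ ()) (λ ()) B B')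
  blockingSide-unique {s₂} {s₃} B B' = ⊥-elim (two-blocking-sides s₂ s₃ s₁ (λ ()) (λ ()) (λ ()) B B')
  blockingSide-unique {s₃} {s₂} B B' = ⊥-elim (two-blocking-sides s₃ s₂ s₁ (λ ()) (λ ()) (λ ()) B B')

  uniform⇒¬blockingSide : (∀ s → c s ≡ c s₁) → ∀ s → ¬ BlockingSide σ F s
  uniform⇒¬blockingSide uniform s B =
    not-¬ refl (trans (uniform s) (trans (sym (uniform (next s))) (other (B (next s)) (next≢ s))))
    where
    next : Side → Side
    next s₁ = s₂
    next s₂ = s₃
    next s₃ = s₁
    next≢ : ∀ s → next s ≢ s
    next≢ s₁ ()
    next≢ s₂ ()
    next≢ s₃ ()

directed⇒uniform : ∀ σ F → Directed σ F → ∀ s → ccwAt σ F s ≡ ccwAt σ F s₁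
directed⇒uniform σ (i , j , up)   = uniform-ccw σ (i , j , up)
directed⇒uniform σ (i , j , down) = uniform-ccw σ (i , j , down)

directed⇒¬blockingSide : ∀ σ F → Directed σ F → ∀ s → ¬ BlockingSide σ F s
directed⇒¬blockingSide σ F d = uniform⇒¬blockingSide σ F (directed⇒uniform σ F d)

almostDirected⇒blockingSide : ∀ σ F e → AlmostDirectedBlocking σ F e →
                              Σ Side λ s → e ≡ edgeAt F s × BlockingSide σ F s
almostDirected⇒blockingSide σ (i , j , up)   = blocking-side σ (i , j , up)
almostDirected⇒blockingSide σ (i , j , down) = blocking-side σ (i , j , down)

-- Cycles and their interior

stepsFrom : Vertex → List Vertex → List (Vertex × Vertex)
stepsFrom w []          = []
stepsFrom w (x ∷ [])    = (x , w) ∷ []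
stepsFrom w (x ∷ y ∷ r) = (x , y) ∷ stepsFrom w (y ∷ r)

-- steps is defined through a local function closing the cycle at w; stepsFrom names it.
steps-∷∷ : ∀ w x r → steps (w ∷ x ∷ r) ≡ (w , x) ∷ stepsFrom w (x ∷ r)
steps-∷∷ w x []      = refl
steps-∷∷ w x (y ∷ r) = cong (λ z → (w , x) ∷ (x , y) ∷ z) (cong (drop 1) (steps-∷∷ w y r))

∈-stepsFrom : ∀ {w a b} P → (a , b) ∈ stepsFrom w P → a ∈ P × (b ∈ P ⊎ b ≡ w)
∈-stepsFrom (x ∷ [])    (here refl) = here refl , inj₂ refl
∈-stepsFrom (x ∷ y ∷ r) (here refl) = here refl , inj₁ (there (here refl))
∈-stepsFrom (x ∷ y ∷ r) (there m) with ∈-stepsFrom (y ∷ r) m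
... | a∈ , inj₁ b∈ = there a∈ , inj₁ (there b∈)
... | a∈ , inj₂ b≡ = there a∈ , inj₂ b≡

∈-steps : ∀ C {a b} → (a , b) ∈ steps C → a ∈ C × b ∈ C
∈-steps (c ∷ []) (here refl) = here refl , here refl
∈-steps (c ∷ x ∷ r) {a} {b} m with ∈-stepsFrom (c ∷ x ∷ r) (subst ((a , b) ∈_) (steps-∷∷ c x r) m)
... | a∈ , inj₁ b∈ = a∈ , b∈
... | a∈ , inj₂ refl = a∈ , here refl

joinsStep : Edge → Vertex × Vertex → Bool
joinsStep e (u , w) = joins e u w

joins-endpoint : ∀ e {x y a b} → T (joins e x y) → T (joins e a b) → x ≡ a ⊎ x ≡ b
joins-endpoint e t t' with joins-ends e t | joins-ends e t'
... | inj₁ (p , _) | inj₁ (p' , _) = inj₁ (trans (sym p) p')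
... | inj₁ (p , _) | inj₂ (p' , _) = inj₂ (trans (sym p) p')
... | inj₂ (_ , q) | inj₁ (_ , q') = inj₂ (trans (sym q) q')
... | inj₂ (_ , q) | inj₂ (_ , q') = inj₁ (trans (sym q) q')

-- The first vertex of a step occurs in no later step of an open path ending at w ∉ P.
stepsFrom-count≤1 : ∀ e w P → Unique P → w ∉ P → count (joinsStep e) (stepsFrom w P) ≤ 1
stepsFrom-count≤1 e w []          _ _ = z≤n
stepsFrom-count≤1 e w (x ∷ [])    _ _ = count≤1-∷ (joinsStep e) (x , w) [] (λ _ ()) z≤n
stepsFrom-count≤1 e w (x ∷ y ∷ r) u w∉ =
  count≤1-∷ (joinsStep e) (x , y) (stepsFrom w (y ∷ r)) later
    (stepsFrom-count≤1 e w (y ∷ r) (Uniqueₚ.drop⁺ 1 u) (w∉ ∘ there))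
  where
  later : T (joins e x y) → ∀ {s} → s ∈ stepsFrom w (y ∷ r) → ¬ T (joinsStep e s)
  later txy {a , b} m tab with ∈-stepsFrom (y ∷ r) m | joins-endpoint e txy tab
  ... | a∈ , _          | inj₁ refl = Unique[x∷xs]⇒x∉xs u a∈
  ... | _  , inj₁ b∈    | inj₂ refl = Unique[x∷xs]⇒x∉xs u b∈
  ... | _  , inj₂ refl  | inj₂ refl = w∉ (here refl)

cycle-count≤1 : ∀ e C → IsCycle C → count (joinsStep e) (steps C) ≤ 1
cycle-count≤1 e []                (() , _)
cycle-count≤1 e (_ ∷ [])          (s≤s () , _)
cycle-count≤1 e (_ ∷ _ ∷ [])      (s≤s (s≤s ()) , _)
cycle-count≤1 e (c ∷ c₁ ∷ c₂ ∷ r) (_ , u , _) =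
  subst (λ l → count (joinsStep e) l ≤ 1) (sym (steps-∷∷ c c₁ (c₂ ∷ r)))
    (count≤1-∷ (joinsStep e) (c , c₁) (stepsFrom c (c₁ ∷ c₂ ∷ r)) later
      (stepsFrom-count≤1 e c (c₁ ∷ c₂ ∷ r) (Uniqueₚ.drop⁺ 1 u) (Unique[x∷xs]⇒x∉xs u)))
  where
  later : T (joins e c c₁) → ∀ {s} → s ∈ stepsFrom c (c₁ ∷ c₂ ∷ r) → ¬ T (joinsStep e s)
  later tcc₁ (here refl) t with joins-endpoint e (subst T (joins-sym e c₂ c₁) t) tcc₁
  ... | inj₁ refl = Unique[x∷xs]⇒x∉xs u (there (here refl))
  ... | inj₂ refl = Unique[x∷xs]⇒x∉xs (Uniqueₚ.drop⁺ 1 u) (here refl)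
  later tcc₁ {a , b} (there m) t with joins-endpoint e t tcc₁
  ... | inj₁ refl = Unique[x∷xs]⇒x∉xs u (there (proj₁ (∈-stepsFrom (c₂ ∷ r) m)))
  ... | inj₂ refl = Unique[x∷xs]⇒x∉xs (Uniqueₚ.drop⁺ 1 u) (proj₁ (∈-stepsFrom (c₂ ∷ r) m))

cycle-count≡1 : ∀ e C → IsCycle C → T (onCycle C e) → count (joinsStep e) (steps C) ≡ 1
cycle-count≡1 e C cyc t = ℕₚ.≤-antisym (cycle-count≤1 e C cyc) (count≥1 (joinsStep e) (steps C) t)

private
  ≤ℤ-split : ∀ a b → (a ≤ℤ b) ≡ (a <ℤ b) ∨ (b ==ℤ a)
  ≤ℤ-split a b with a ℤ.<? b | a ℤ.≤? b | b ℤ.≟ a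
  ... | yes a<b | no a≰b | _        = ⊥-elim (a≰b (ℤₚ.<⇒≤ a<b))
  ... | yes _   | yes _  | _        = refl
  ... | no a≮b  | yes a≤b | no b≢a  = ⊥-elim (a≮b (ℤₚ.≤∧≢⇒< a≤b (b≢a ∘ sym)))
  ... | no _    | yes _  | yes _    = refl
  ... | no _    | no a≰b | yes refl = ⊥-elim (a≰b ℤₚ.≤-refl)
  ... | no _    | no _   | no _     = refl

  pred<ℤ : ∀ a b → ((a ℤ.- 1ℤ) <ℤ b) ≡ (a ≤ℤ b)
  pred<ℤ a b with (a ℤ.- 1ℤ) ℤ.<? b | a ℤ.≤? b
  ... | yes _ | yes _ = refl
  ... | no _  | no _  = refl
  ... | yes a-1<b | no a≰b  = ⊥-elim (a≰b (subst (ℤ._≤ b) (1+[i-1]≡i a) (ℤₚ.i<j⇒suc[i]≤j a-1<b)))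
  ... | no a-1≮b  | yes a≤b = ⊥-elim (a-1≮b (ℤₚ.suc[i]≤j⇒i<j (subst (ℤ._≤ b) (sym (1+[i-1]≡i a)) a≤b)))

  <ℤ-irrefl : ∀ a → (a <ℤ a) ≡ false
  <ℤ-irrefl a = dec-false (a ℤ.<? a) (ℤₚ.<-irrefl refl)

  ∧-∧-false : ∀ x y → x ∧ (y ∧ false) ≡ false
  ∧-∧-false true  y = ∧-zeroʳ y
  ∧-∧-false false y = refl

  ∧-∨-distrib : ∀ a x y → a ∧ (x ∨ y) ≡ (a ∧ x) ∨ (y ∧ (a ∧ true))
  ∧-∨-distrib true  true  y     = refl
  ∧-∨-distrib true  false true  = refl
  ∧-∨-distrib true  false false = refl
  ∧-∨-distrib false x     true  = refl
  ∧-∨-distrib false x     false = refl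

  crossesRay-across-dia : ∀ k l e' →
    crossesRay (k , l ℤ.- 1ℤ , up) e' ≡ crossesRay (k , l ℤ.- 1ℤ , down) e' ∨ (e' ==ₑ (k , l , dia))
  crossesRay-across-dia k l (k' , l' , hor) = sym (∧-∧-false (k' ==ℤ k) (l' ==ℤ l))
  crossesRay-across-dia k l (k' , l' , ver) rewrite ∧-∧-false (k' ==ℤ k) (l' ==ℤ l) = sym (∨-identityʳ _)
  crossesRay-across-dia k l (k' , l' , dia) rewrite i-1+1≡i l | ≤ℤ-split k k' =
    ∧-∨-distrib (l' ==ℤ l) (k <ℤ k') (k' ==ℤ k)

  crossesRay-across-ver : ∀ k j e' →
    crossesRay (k ℤ.- 1ℤ , j , down) e' ≡ crossesRay (k , j , up) e' ∨ (e' ==ₑ (k , j , ver))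
  crossesRay-across-ver k j (k' , l' , hor) = sym (∧-∧-false (k' ==ℤ k) (l' ==ℤ j))
  crossesRay-across-ver k j (k' , l' , ver) rewrite pred<ℤ k k' | ≤ℤ-split k k' =
    ∧-∨-distrib (l' ==ℤ j) (k <ℤ k') (k' ==ℤ k)
  crossesRay-across-ver k j (k' , l' , dia) rewrite ∧-∧-false (k' ==ℤ k) (l' ==ℤ j) | pred<ℤ k k' = sym (∨-identityʳ _)

  ¬ray-ver : ∀ k j → crossesRay (k , j , up) (k , j , ver) ≡ false
  ¬ray-ver k j rewrite <ℤ-irrefl k = ∧-zeroʳ _

  ¬ray-dia : ∀ k l → crossesRay (k , l ℤ.- 1ℤ , down) (k , l , dia) ≡ false
  ¬ray-dia k l rewrite <ℤ-irrefl k = ∧-zeroʳ _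


module _ (C : List Vertex) (cyc : IsCycle C) where

  module RayAcross (F F' : Face) (e : Edge)
    (ray≡ : ∀ e' → crossesRay F e' ≡ crossesRay F' e' ∨ (e' ==ₑ e))
    (¬ray' : crossesRay F' e ≡ false) where

    private
      any-∨ : ∀ {A : Set} (f g k : A → Bool) xs →
              any (λ x → f x ∧ (g x ∨ k x)) xs ≡ any (λ x → f x ∧ g x) xs ∨ any (λ x → f x ∧ k x) xs
      any-∨ f g k [] = refl
      any-∨ f g k (x ∷ xs) with f x | g x | k x
      ... | false | _     | _     = any-∨ f g k xs
      ... | true  | true  | _     = refl
      ... | true  | false | true  = sym (∨-zeroʳ _)
      ... | true  | false | false = any-∨ f g k xs

      any-cong : ∀ {A : Set} {f g : A → Bool} xs → (∀ x → f x ≡ g x) → any f xs ≡ any g xs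
      any-cong []       _  = refl
      any-cong (x ∷ xs) eq = cong₂ _∨_ (eq x) (any-cong xs eq)

    stepCrosses≡ : ∀ s → stepCrosses F s ≡ stepCrosses F' s ∨ joinsStep e s
    stepCrosses≡ (u , w) =
      trans (any-cong (incident u) (λ e' → cong (joins e' u w ∧_) (ray≡ e')))
      (trans (any-∨ (λ e' → joins e' u w) (crossesRay F') (_==ₑ e) (incident u))
             (cong (stepCrosses F' (u , w) ∨_) (any-incident-joins e u w)))

    crossings≡ : crossings C F ≡ crossings C F' + count (joinsStep e) (steps C)
    crossings≡ = count-∨ (stepCrosses F) (stepCrosses F') (joinsStep e) stepCrosses≡ (steps C) excl
      where
      excl : ∀ {s} → s ∈ steps C → T (stepCrosses F' s) → ¬ T (joinsStep e s)
      excl {u , w} _ t t' with find (any⁻ (λ e' → joins e' u w ∧ crossesRay F' e') (incident u) t)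
      ... | e' , _ , t'' with joins-unique e' e (T-∧ˡ t'') t'
      ... | refl = subst T ¬ray' (T-∧ʳ {joins e' u w} t'')

    one-side-inside : T (onCycle C e) → T (insideᵇ C F) ⊎ T (insideᵇ C F')
    one-side-inside t with insideᵇ C F | insideᵇ C F' | flips
      where
      flips : insideᵇ C F ≡ not (insideᵇ C F')
      flips rewrite crossings≡ | cycle-count≡1 e C cyc t | ℕₚ.+-comm (crossings C F') 1 = refl
    ... | true  | _    | _ = inj₁ tt
    ... | false | true | _ = inj₂ tt

  -- Horizontal edges are parallel to the rays, so the parity argument says nothing about them.
  inG⇒adjacent-inside : ∀ e → proj₂ (proj₂ e) ≢ hor → T (inGᵇ C e) →
    T (insideᵇ C (proj₁ (adjFaces e))) ⊎ T (insideᵇ C (proj₂ (adjFaces e)))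
  inG⇒adjacent-inside (k , l , hor) ¬hor _ = ⊥-elim (¬hor refl)
  inG⇒adjacent-inside (k , l , ver) _ t with T-∨⁻ {onCycle C (k , l , ver)} t
  ... | inj₂ both = inj₁ (T-∧ˡ both)
  ... | inj₁ on with RayAcross.one-side-inside (k ℤ.- 1ℤ , l , down) (k , l , up) (k , l , ver)
                       (crossesRay-across-ver k l) (¬ray-ver k l) on
  ...   | inj₁ down-in = inj₂ down-in
  ...   | inj₂ up-in   = inj₁ up-in
  inG⇒adjacent-inside (k , l , dia) _ t with T-∨⁻ {onCycle C (k , l , dia)} t
  ... | inj₂ both = inj₁ (T-∧ˡ both)
  ... | inj₁ on = RayAcross.one-side-inside (k , l ℤ.- 1ℤ , up) (k , l ℤ.- 1ℤ , down) (k , l , dia)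
                    (crossesRay-across-dia k l) (¬ray-dia k l) on

xmax : List Vertex → ℤ
xmax []       = 0ℤ
xmax (v ∷ vs) = proj₁ v ℤ.⊔ xmax vs

≤xmax : ∀ C {v} → v ∈ C → proj₁ v ℤ.≤ xmax C
≤xmax (v ∷ vs) (here refl) = ℤₚ.i≤i⊔j _ _
≤xmax (v ∷ vs) (there m)   = ℤₚ.≤-trans (≤xmax vs m) (ℤₚ.i≤j⊔i (proj₁ v) _)

crossesRay⇒left-of-head : ∀ F e → T (crossesRay F e) → proj₁ F ℤ.< proj₁ (head e)
crossesRay⇒left-of-head (i , j , up) (k , l , ver) t = <ℤ⇒< (T-∧ʳ {l ==ℤ j} t)
crossesRay⇒left-of-head (i , j , up) (k , l , dia) t =
  ℤₚ.≤-<-trans (≤ℤ⇒≤ (T-∧ʳ {l ==ℤ (j ℤ.+ 1ℤ)} t)) (i<i+1 k)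
crossesRay⇒left-of-head (i , j , down) (k , l , ver) t = <ℤ⇒< (T-∧ʳ {l ==ℤ j} t)
crossesRay⇒left-of-head (i , j , down) (k , l , dia) t =
  ℤₚ.<-trans (<ℤ⇒< (T-∧ʳ {l ==ℤ (j ℤ.+ 1ℤ)} t)) (i<i+1 k)

adjFaces₁-column : ∀ e → proj₁ (base e) ≡ proj₁ (proj₁ (adjFaces e))
adjFaces₁-column (k , l , hor) = refl
adjFaces₁-column (k , l , ver) = refl
adjFaces₁-column (k , l , dia) = refl

module _ (C : List Vertex) where

  cycle-edge≤xmax : ∀ {e u w} → (u , w) ∈ steps C → T (joins e u w) →
                    proj₁ (base e) ℤ.≤ xmax C × proj₁ (head e) ℤ.≤ xmax C
  cycle-edge≤xmax {e} m t with ∈-steps C m | joins-ends e t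
  ... | u∈ , w∈ | inj₁ (refl , refl) = ≤xmax C u∈ , ≤xmax C w∈
  ... | u∈ , w∈ | inj₂ (refl , refl) = ≤xmax C w∈ , ≤xmax C u∈

  outside-right : ∀ F → xmax C ℤ.≤ proj₁ F → insideᵇ C F ≡ false
  outside-right F R≤F = cong oddᵇ (count≡0 (stepCrosses F) (steps C) no-crossing)
    where
    no-crossing : ∀ {s} → s ∈ steps C → ¬ T (stepCrosses F s)
    no-crossing {u , w} m t with find (any⁻ (λ e → joins e u w ∧ crossesRay F e) (incident u) t)
    ... | e , _ , t' = ℤₚ.<-irrefl refl
          (ℤₚ.≤-<-trans (proj₂ (cycle-edge≤xmax {e} m (T-∧ˡ t')))
            (ℤₚ.≤-<-trans R≤F (crossesRay⇒left-of-head F e (T-∧ʳ {joins e u w} t'))))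

  ∉G-right : ∀ e → xmax C ℤ.< proj₁ (base e) → inGᵇ C e ≡ false
  ∉G-right e R<e with onCycle C e in on
  ... | true with find (any⁻ (joinsStep e) (steps C) (subst T (sym on) tt))
  ...   | (u , w) , m , t = ⊥-elim (ℤₚ.<-irrefl refl (ℤₚ.<-≤-trans R<e (proj₁ (cycle-edge≤xmax {e} m t))))
  ∉G-right e R<e | false
    rewrite outside-right (proj₁ (adjFaces e)) (ℤₚ.<⇒≤ (subst (xmax C ℤ.<_) (adjFaces₁-column e) R<e)) = refl

-- Eulerian orientations

weight : Bool → Bool → ℤ
weight true  true  = + 1
weight true  false = ℤ.- (+ 1)
weight false _     = 0ℤ

weight≡difference : ∀ g b → weight g b ≡ + toℕ (g ∧ b) ℤ.- + toℕ (g ∧ not b)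
weight≡difference true  true  = refl
weight≡difference true  false = refl
weight≡difference false true  = refl
weight≡difference false false = refl

∣weight∣≤ : ∀ g x → ∣ weight g x ∣ ≤ toℕ g
∣weight∣≤ true  true  = ℕₚ.≤-refl
∣weight∣≤ true  false = ℕₚ.≤-refl
∣weight∣≤ false _     = z≤n

module _ (τ : Orientation) (e : Edge) (v : Vertex) where

  tail-out : base e ≡ v → head e ≢ v → (tailOf τ e ==ᵥ v) ≡ τ e
  tail-out refl h≢v with τ e
  ... | true  = ==ᵥ-refl (base e)
  ... | false = ==ᵥ-≢ h≢v

  tail-in : head e ≡ v → base e ≢ v → (tailOf τ e ==ᵥ v) ≡ not (τ e)
  tail-in refl b≢v with τ e
  ... | true  = ==ᵥ-≢ b≢v
  ... | false = ==ᵥ-refl (head e)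

module Balance (C : List Vertex) (σ : Orientation) where

  W : Edge → ℤ
  W e = weight (inGᵇ C e) (σ e)

  flow : Vertex → Edge → ℤ
  flow v e = + toℕ (inGᵇ C e ∧ (tailOf σ e ==ᵥ v)) ℤ.- + toℕ (inGᵇ C e ∧ (headOf σ e ==ᵥ v))

  flow-out : ∀ e v → base e ≡ v → head e ≢ v → flow v e ≡ W e
  flow-out e v b≡v h≢v
    rewrite tail-out σ e v b≡v h≢v | tail-out (not ∘ σ) e v b≡v h≢v = sym (weight≡difference (inGᵇ C e) (σ e))

  flow-in : ∀ e v → head e ≡ v → base e ≢ v → flow v e ≡ ℤ.- W e
  flow-in e v h≡v b≢v
    rewrite tail-in σ e v h≡v b≢v | tail-in (not ∘ σ) e v h≡v b≢v | not-involutive (σ e)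
          | weight≡difference (inGᵇ C e) (σ e) =
    swap-difference (+ toℕ (inGᵇ C e ∧ σ e)) (+ toℕ (inGᵇ C e ∧ not (σ e)))
    where
    swap-difference : ∀ a b → b ℤ.- a ≡ ℤ.- (a ℤ.- b)
    swap-difference = solve-∀

  balance : Eulerian C σ → ∀ k j →
    (W (k , j , hor) ℤ.+ W (k , j , ver) ℤ.+ W (k , j , dia)) ℤ.-
    (W (k ℤ.- 1ℤ , j , hor) ℤ.+ W (k , j ℤ.- 1ℤ , ver) ℤ.+ W (k ℤ.- 1ℤ , j ℤ.+ 1ℤ , dia)) ≡ 0ℤ
  balance eu k j = begin
      (W e₁ ℤ.+ W e₃ ℤ.+ W e₅) ℤ.- (W e₂ ℤ.+ W e₄ ℤ.+ W e₆)
    ≡⟨ alternate (W e₁) (W e₂) (W e₃) (W e₄) (W e₅) (W e₆) ⟩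
      W e₁ ℤ.+ (ℤ.- W e₂ ℤ.+ (W e₃ ℤ.+ (ℤ.- W e₄ ℤ.+ (W e₅ ℤ.+ (ℤ.- W e₆ ℤ.+ 0ℤ)))))
    ≡⟨ sym flows ⟩
      foldr (λ e acc → flow v e ℤ.+ acc) 0ℤ (incident v)
    ≡⟨ count-difference (λ e → inGᵇ C e ∧ (tailOf σ e ==ᵥ v)) (λ e → inGᵇ C e ∧ (headOf σ e ==ᵥ v))
                        (incident v) ⟨
      + outdeg C σ v ℤ.- + indeg C σ v
    ≡⟨ cong (λ n → + n ℤ.- + indeg C σ v) (eu v) ⟩
      + indeg C σ v ℤ.- + indeg C σ v
    ≡⟨ ℤₚ.+-inverseʳ (+ indeg C σ v) ⟩
      0ℤ ∎
    where
    open ≡-Reasoning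
    v : Vertex
    v = k , j
    e₁ e₂ e₃ e₄ e₅ e₆ : Edge
    e₁ = k , j , hor
    e₂ = k ℤ.- 1ℤ , j , hor
    e₃ = k , j , ver
    e₄ = k , j ℤ.- 1ℤ , ver
    e₅ = k , j , dia
    e₆ = k ℤ.- 1ℤ , j ℤ.+ 1ℤ , dia
    alternate : ∀ a b c d e f → (a ℤ.+ c ℤ.+ e) ℤ.- (b ℤ.+ d ℤ.+ f) ≡
                a ℤ.+ (ℤ.- b ℤ.+ (c ℤ.+ (ℤ.- d ℤ.+ (e ℤ.+ (ℤ.- f ℤ.+ 0ℤ)))))
    alternate = solve-∀
    flows : foldr (λ e acc → flow v e ℤ.+ acc) 0ℤ (incident v) ≡
            W e₁ ℤ.+ (ℤ.- W e₂ ℤ.+ (W e₃ ℤ.+ (ℤ.- W e₄ ℤ.+ (W e₅ ℤ.+ (ℤ.- W e₆ ℤ.+ 0ℤ)))))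
    flows =
      cong₂ ℤ._+_ (flow-out e₁ v refl (i+1≢i k ∘ cong proj₁)) (
      cong₂ ℤ._+_ (flow-in e₂ v (cong (_, j) (i-1+1≡i k)) (i-1≢i k ∘ cong proj₁)) (
      cong₂ ℤ._+_ (flow-out e₃ v refl (i+1≢i j ∘ cong proj₂)) (
      cong₂ ℤ._+_ (flow-in e₄ v (cong (k ,_) (i-1+1≡i j)) (i-1≢i j ∘ cong proj₂)) (
      cong₂ ℤ._+_ (flow-out e₅ v refl (i+1≢i k ∘ cong proj₁)) (
      cong₂ ℤ._+_ (flow-in e₆ v (cong₂ _,_ (i-1+1≡i k) (i+1-1≡i j)) (i-1≢i k ∘ cong proj₁)) refl)))))

-- The height function

i+1+t-1≡i+t : ∀ i t → ((i ℤ.+ 1ℤ) ℤ.+ t) ℤ.- 1ℤ ≡ i ℤ.+ t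
i+1+t-1≡i+t = solve-∀

i+n+1≡i+[1+n] : ∀ i n → (i ℤ.+ + n) ℤ.+ 1ℤ ≡ i ℤ.+ + suc n
i+n+1≡i+[1+n] i n = trans (reassoc i (+ n)) (cong (λ z → i ℤ.+ z) (sym (ℤₚ.pos-+ 1 n)))
  where
  reassoc : ∀ i t → (i ℤ.+ t) ℤ.+ 1ℤ ≡ i ℤ.+ (1ℤ ℤ.+ t)
  reassoc = solve-∀

module RaySums (R : ℤ) where

  Vanishes : (ℤ → ℤ) → Set
  Vanishes g = ∀ k → R ℤ.< k → g k ≡ 0ℤ

  window : (ℤ → ℤ) → ℤ → ℕ → ℤ
  window g a n = ∑ℤ n (λ s → g (a ℤ.+ + s))

  -- One column more than needed, so that a ray started one column later still reaches past R.
  reach : ℤ → ℕ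
  reach a = 2 + ∣ R ℤ.- a ∣

  ray : (ℤ → ℤ) → ℤ → ℤ
  ray g a = window g a (reach a)

  R<a-1+reach : ∀ a → R ℤ.< (a ℤ.- 1ℤ) ℤ.+ + reach a
  R<a-1+reach a = ℤₚ.suc[i]≤j⇒i<j (ℤₚ.≤-trans (ℤₚ.≤-reflexive (split R a))
    (ℤₚ.+-monoʳ-≤ (a ℤ.- 1ℤ) (ℤₚ.+-monoʳ-≤ (+ 2) (i≤+∣i∣ (R ℤ.- a)))))
    where
    i≤+∣i∣ : ∀ i → i ℤ.≤ + ∣ i ∣
    i≤+∣i∣ (+ n)      = ℤₚ.≤-refl
    i≤+∣i∣ ℤ.-[1+ n ] = ℤ.-≤+
    split : ∀ R a → 1ℤ ℤ.+ R ≡ (a ℤ.- 1ℤ) ℤ.+ (+ 2 ℤ.+ (R ℤ.- a))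
    split = solve-∀

  R<a+reach : ∀ a → R ℤ.< a ℤ.+ + reach a
  R<a+reach a = ℤₚ.<-trans (R<a-1+reach a) (ℤₚ.+-monoˡ-< (+ reach a) (i-1<i a))

  R<a+1+reach : ∀ a → R ℤ.< (a ℤ.+ 1ℤ) ℤ.+ + reach a
  R<a+1+reach a = ℤₚ.<-trans (R<a+reach a) (ℤₚ.+-monoˡ-< (+ reach a) (i<i+1 a))

  window-suc : ∀ g a n → window g a (suc n) ≡ g a ℤ.+ window g (a ℤ.+ 1ℤ) n
  window-suc g a n = cong₂ ℤ._+_ (cong g (ℤₚ.+-identityʳ a)) (∑ℤ-cong n (cong g ∘ i+[1+n]≡i+1+n a))

  window-extend : ∀ {g} a n m → Vanishes g → R ℤ.< a ℤ.+ + n → window g a (m + n) ≡ window g a n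
  window-extend     a n zero    _   _   = refl
  window-extend {g} a n (suc m) van R< =
    trans (∑ℤ-suc (m + n) (λ s → g (a ℤ.+ + s)))
      (trans (cong₂ ℤ._+_ (window-extend a n m van R<) (van _ (ℤₚ.<-≤-trans R< (ℤₚ.+-monoʳ-≤ a (ℤ.+≤+ (ℕₚ.m≤n+m n m))))))
             (ℤₚ.+-identityʳ _))

  window-stable : ∀ {g} a n n' → Vanishes g → R ℤ.< a ℤ.+ + n → R ℤ.< a ℤ.+ + n' → window g a n ≡ window g a n'
  window-stable {g} a n n' van R<n R<n' with ℕₚ.≤-total n n'
  ... | inj₁ n≤n' =
    sym (subst (λ z → window g a z ≡ window g a n) (ℕₚ.m∸n+n≡m n≤n') (window-extend a n (n' ℕ.∸ n) van R<n))
  ... | inj₂ n'≤n =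
    subst (λ z → window g a z ≡ window g a n') (ℕₚ.m∸n+n≡m n'≤n) (window-extend a n' (n ℕ.∸ n') van R<n')

  ray≡window : ∀ {g} a n → Vanishes g → R ℤ.< a ℤ.+ + n → ray g a ≡ window g a n
  ray≡window a n van = window-stable a (reach a) n van (R<a+reach a)

  ray-step : ∀ {g} a → Vanishes g → ray g a ≡ g a ℤ.+ ray g (a ℤ.+ 1ℤ)
  ray-step {g} a van = trans (ray≡window a (suc (reach (a ℤ.+ 1ℤ))) van R<)
                             (window-suc g a (reach (a ℤ.+ 1ℤ)))
    where
    R< : R ℤ.< a ℤ.+ + suc (reach (a ℤ.+ 1ℤ))
    R< = subst (R ℤ.<_) (sym (i+[1+n]≡i+1+n a _)) (R<a+reach (a ℤ.+ 1ℤ))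

  ray-pred : ∀ {g} a → Vanishes g → ray (λ k → g (k ℤ.- 1ℤ)) (a ℤ.+ 1ℤ) ≡ ray g a
  ray-pred {g} a van = trans (∑ℤ-cong n (λ s → cong g (i+1+t-1≡i+t a (+ s)))) (sym (ray≡window a n van R<))
    where
    n : ℕ
    n = reach (a ℤ.+ 1ℤ)
    R< : R ℤ.< a ℤ.+ + n
    R< = subst (λ z → R ℤ.< z ℤ.+ + n) (i+1-1≡i a) (R<a-1+reach (a ℤ.+ 1ℤ))

sign : Bool → ℤ
sign true  = + 1
sign false = ℤ.- (+ 1)

signed : Bool → ℤ → ℤ
signed true  x = ℤ.- x
signed false x = x

signed-weight : ∀ b x → signed b (weight true x) ≡ sign (not (not (x xor b)))
signed-weight true  true  = refl
signed-weight true  false = refl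
signed-weight false true  = refl
signed-weight false false = refl

∣signed-weight∣≤1 : ∀ b g x → ∣ signed b (weight g x) ∣ ≤ 1
∣signed-weight∣≤1 true  true  true  = ℕₚ.≤-refl
∣signed-weight∣≤1 true  true  false = ℕₚ.≤-refl
∣signed-weight∣≤1 true  false _     = z≤n
∣signed-weight∣≤1 false true  true  = ℕₚ.≤-refl
∣signed-weight∣≤1 false true  false = ℕₚ.≤-refl
∣signed-weight∣≤1 false false _     = z≤n

a≡b+x⇒b≡a-x : ∀ {a b x} → a ≡ b ℤ.+ x → b ≡ a ℤ.+ signed true x
a≡b+x⇒b≡a-x {b = b} {x} refl = solve b x
  where
  solve : ∀ b x → b ≡ (b ℤ.+ x) ℤ.+ ℤ.- x
  solve = solve-∀

module Height (C : List Vertex) (σ : Orientation) (eu : Eulerian C σ) where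
  open Balance C σ public
  open RaySums (xmax C) public

  W-vanishes : ∀ d l → Vanishes (λ k → W (k , l , d))
  W-vanishes d l k R<k rewrite ∉G-right C (k , l , d) R<k = refl

  V D H : ℤ → ℤ → ℤ
  V j a = ray (λ k → W (k , j , ver)) a
  D l a = ray (λ k → W (k , l , dia)) a
  H j a = ray (λ k → W (k , j , hor)) a

  -- The signed number of edges of G(C) crossed by the ray of the face (see crossesRay).
  height : Face → ℤ
  height (i , j , up)   = V j (i ℤ.+ 1ℤ) ℤ.- D (j ℤ.+ 1ℤ) i
  height (i , j , down) = V j (i ℤ.+ 1ℤ) ℤ.- D (j ℤ.+ 1ℤ) (i ℤ.+ 1ℤ)

  height-across-dia : ∀ i j → height (i , j , down) ≡ height (i , j , up) ℤ.+ W (i , j ℤ.+ 1ℤ , dia)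
  height-across-dia i j =
    trans (peel (V j (i ℤ.+ 1ℤ)) (W (i , j ℤ.+ 1ℤ , dia)) (D (j ℤ.+ 1ℤ) (i ℤ.+ 1ℤ)))
          (cong (λ z → (V j (i ℤ.+ 1ℤ) ℤ.- z) ℤ.+ W (i , j ℤ.+ 1ℤ , dia)) (sym (ray-step i (W-vanishes dia (j ℤ.+ 1ℤ)))))
    where
    peel : ∀ a x b → a ℤ.- b ≡ (a ℤ.- (x ℤ.+ b)) ℤ.+ x
    peel = solve-∀

  height-across-ver : ∀ i j → height (i , j , down) ≡ height (i ℤ.+ 1ℤ , j , up) ℤ.+ W (i ℤ.+ 1ℤ , j , ver)
  height-across-ver i j =
    trans (cong (λ z → z ℤ.- D (j ℤ.+ 1ℤ) (i ℤ.+ 1ℤ)) (ray-step (i ℤ.+ 1ℤ) (W-vanishes ver j)))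
          (peel (W (i ℤ.+ 1ℤ , j , ver)) (V j ((i ℤ.+ 1ℤ) ℤ.+ 1ℤ)) (D (j ℤ.+ 1ℤ) (i ℤ.+ 1ℤ)))
    where
    peel : ∀ x a b → (x ℤ.+ a) ℤ.- b ≡ (a ℤ.- b) ℤ.+ x
    peel = solve-∀

  -- The balances at the vertices (k , j), k > i, summed along the ray.
  row-balance : ∀ i j → let i₁ = i ℤ.+ 1ℤ in
    (H j i₁ ℤ.+ V j i₁ ℤ.+ D j i₁) ℤ.- (H j i ℤ.+ V (j ℤ.- 1ℤ) i₁ ℤ.+ D (j ℤ.+ 1ℤ) i) ≡ 0ℤ
  row-balance i j = begin
      (H j i₁ ℤ.+ V j i₁ ℤ.+ D j i₁) ℤ.- (H j i ℤ.+ V (j ℤ.- 1ℤ) i₁ ℤ.+ D (j ℤ.+ 1ℤ) i)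
    ≡⟨ cong (λ z → (H j i₁ ℤ.+ V j i₁ ℤ.+ D j i₁) ℤ.- z)
            (cong₂ ℤ._+_ (cong (ℤ._+ V (j ℤ.- 1ℤ) i₁) (ray-pred i (W-vanishes hor j)))
                         (ray-pred i (W-vanishes dia (j ℤ.+ 1ℤ)))) ⟨
      (H j i₁ ℤ.+ V j i₁ ℤ.+ D j i₁) ℤ.-
      (ray (λ k → W (k ℤ.- 1ℤ , j , hor)) i₁ ℤ.+ V (j ℤ.- 1ℤ) i₁ ℤ.+ ray (λ k → W (k ℤ.- 1ℤ , j ℤ.+ 1ℤ , dia)) i₁)
    ≡⟨ ∑ℤ-six (reach i₁) (along hor j) (along ver j) (along dia j)
              (λ s → W ((i₁ ℤ.+ + s) ℤ.- 1ℤ , j , hor)) (along ver (j ℤ.- 1ℤ))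
              (λ s → W ((i₁ ℤ.+ + s) ℤ.- 1ℤ , j ℤ.+ 1ℤ , dia)) ⟨
      ray (λ k → (W (k , j , hor) ℤ.+ W (k , j , ver) ℤ.+ W (k , j , dia)) ℤ.-
                 (W (k ℤ.- 1ℤ , j , hor) ℤ.+ W (k , j ℤ.- 1ℤ , ver) ℤ.+ W (k ℤ.- 1ℤ , j ℤ.+ 1ℤ , dia))) i₁
    ≡⟨ ∑ℤ-zero (reach i₁) (λ s → balance eu (i₁ ℤ.+ + s) j) ⟩
      0ℤ ∎
    where
    open ≡-Reasoning
    i₁ : ℤ
    i₁ = i ℤ.+ 1ℤ
    along : Dir → ℤ → ℕ → ℤ
    along d l s = W (i₁ ℤ.+ + s , l , d)

  height-across-hor : ∀ i j → height (i , j , up) ≡ height (i , j ℤ.- 1ℤ , down) ℤ.+ W (i , j , hor)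
  height-across-hor i j =
    trans (solve-row (H j i₁) (V j i₁) (D j i₁) (W (i , j , hor)) (V (j ℤ.- 1ℤ) i₁) (D (j ℤ.+ 1ℤ) i) eq)
          (cong (λ z → (V (j ℤ.- 1ℤ) i₁ ℤ.- D z i₁) ℤ.+ W (i , j , hor)) (sym (i-1+1≡i j)))
    where
    i₁ : ℤ
    i₁ = i ℤ.+ 1ℤ
    eq : (H j i₁ ℤ.+ V j i₁ ℤ.+ D j i₁) ℤ.- ((W (i , j , hor) ℤ.+ H j i₁) ℤ.+ V (j ℤ.- 1ℤ) i₁ ℤ.+ D (j ℤ.+ 1ℤ) i) ≡ 0ℤ
    eq = trans (cong (λ z → (H j i₁ ℤ.+ V j i₁ ℤ.+ D j i₁) ℤ.- (z ℤ.+ V (j ℤ.- 1ℤ) i₁ ℤ.+ D (j ℤ.+ 1ℤ) i))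
                     (sym (ray-step i (W-vanishes hor j))))
               (row-balance i j)
    solve-row : ∀ h v d x v' d' → (h ℤ.+ v ℤ.+ d) ℤ.- ((x ℤ.+ h) ℤ.+ v' ℤ.+ d') ≡ 0ℤ → v ℤ.- d' ≡ (v' ℤ.- d) ℤ.+ x
    solve-row h v d x v' d' e = trans (split h v d x v' d') (trans (cong (λ z → ((v' ℤ.- d) ℤ.+ x) ℤ.+ z) e) (ℤₚ.+-identityʳ _))
      where
      split : ∀ h v d x v' d' → v ℤ.- d' ≡ ((v' ℤ.- d) ℤ.+ x) ℤ.+ ((h ℤ.+ v ℤ.+ d) ℤ.- ((x ℤ.+ h) ℤ.+ v' ℤ.+ d'))
      split = solve-∀

  height-across : ∀ F s → height (neighbour F s) ≡ height F ℤ.+ signed (proj₂ (side F s)) (W (edgeAt F s))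
  height-across (i , j , up)   s₁ = a≡b+x⇒b≡a-x (height-across-hor i j)
  height-across (i , j , up)   s₂ = height-across-dia i j
  height-across (i , j , up)   s₃ =
    trans (height-across-ver (i ℤ.- 1ℤ) j) (cong (λ z → height (z , j , up) ℤ.+ W (z , j , ver)) (i-1+1≡i i))
  height-across (i , j , down) s₁ = a≡b+x⇒b≡a-x (height-across-ver i j)
  height-across (i , j , down) s₂ =
    trans (height-across-hor i (j ℤ.+ 1ℤ)) (cong (λ z → height (i , z , down) ℤ.+ W (i , j ℤ.+ 1ℤ , hor)) (i+1-1≡i j))
  height-across (i , j , down) s₃ = a≡b+x⇒b≡a-x (height-across-dia i j)

  step-height : ∀ F s → T (inGᵇ C (edgeAt F s)) → height (neighbour F s) ≡ height F ℤ.+ sign (not (ccwAt σ F s))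
  step-height F s t = trans (height-across F s) (cong (λ z → height F ℤ.+ z) jump)
    where
    e : Edge
    e = edgeAt F s
    jump : signed (proj₂ (side F s)) (W e) ≡ sign (not (ccwAt σ F s))
    jump = trans (cong (λ g → signed (proj₂ (side F s)) (weight g (σ e))) (T⇒≡true t))
                 (signed-weight (proj₂ (side F s)) (σ e))

  ∣height∣-across : ∀ F s → ∣ height F ∣ ≤ ∣ height (neighbour F s) ∣ + 1
  ∣height∣-across F s = begin
      ∣ height F ∣
    ≡⟨ cong ∣_∣ (a≡b+x⇒b≡a-x {height (neighbour F s)} {height F} {x} (height-across F s)) ⟩
      ∣ height (neighbour F s) ℤ.- x ∣
    ≤⟨ ℤₚ.∣i-j∣≤∣i∣+∣j∣ (height (neighbour F s)) x ⟩
      ∣ height (neighbour F s) ∣ + ∣ x ∣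
    ≤⟨ ℕₚ.+-monoʳ-≤ ∣ height (neighbour F s) ∣ (∣signed-weight∣≤1 (proj₂ (side F s)) (inGᵇ C (edgeAt F s)) (σ (edgeAt F s))) ⟩
      ∣ height (neighbour F s) ∣ + 1 ∎
    where
    open ℕₚ.≤-Reasoning
    x : ℤ
    x = signed (proj₂ (side F s)) (W (edgeAt F s))

-- Towers

lastOf : Face → List Face → Face
lastOf F []      = F
lastOf F (G ∷ r) = lastOf G r

adjacent-inside⇒inG : ∀ C e → T (insideᵇ C (proj₁ (adjFaces e))) → T (insideᵇ C (proj₂ (adjFaces e))) → T (inGᵇ C e)
adjacent-inside⇒inG C e = or-both {onCycle C e}
  where
  or-both : ∀ {o a b} → T a → T b → T (o ∨ (a ∧ b))
  or-both {true}                 _ _ = tt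
  or-both {false} {true} {true}  _ _ = tt

inside-both⇒inG : ∀ C F s → T (insideᵇ C F) → T (insideᵇ C (neighbour F s)) → T (inGᵇ C (edgeAt F s))
inside-both⇒inG C F s inF inN with adjFaces-edgeAt F s
... | inj₁ eq = adjacent-inside⇒inG C (edgeAt F s)
                  (subst (T ∘ insideᵇ C ∘ proj₁) (sym eq) inF) (subst (T ∘ insideᵇ C ∘ proj₂) (sym eq) inN)
... | inj₂ eq = adjacent-inside⇒inG C (edgeAt F s)
                  (subst (T ∘ insideᵇ C ∘ proj₁) (sym eq) inN) (subst (T ∘ insideᵇ C ∘ proj₂) (sym eq) inF)

tower-inside : ∀ {C σ} F rest → IsTower C σ (F ∷ rest) → T (insideᵇ C F)
tower-inside F []      tower = proj₁ tower
tower-inside F (_ ∷ _) tower = proj₁ tower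

module Towers (C : List Vertex) (σ : Orientation) (eu : Eulerian C σ) where
  open Height C σ eu

  -- A tower entering a face through its blocking side would have to bounce back and forth forever.
  tower-cannot-turn-back : ∀ F s rest → BlockingSide σ F s → BlockingSide σ (neighbour F s) (mirror F s) →
                           ¬ IsTower C σ (neighbour F s ∷ rest)
  tower-cannot-turn-back F s [] _ B' (_ , dir) = directed⇒¬blockingSide σ (neighbour F s) dir (mirror F s) B'
  tower-cannot-turn-back F s (G ∷ rest) B B' (_ , N≢G , (e , _ , onG , adb) , tower)
    with almostDirected⇒blockingSide σ (neighbour F s) e adb
  ... | s' , refl , B'' with blockingSide-unique σ (neighbour F s) B'' B'
  ... | refl = tower-cannot-turn-back (neighbour F s) (mirror F s) rest B' B-back
                 (subst (λ X → IsTower C σ (X ∷ rest)) G≡ tower)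
    where
    G≡ : G ≡ neighbour (neighbour F s) (mirror F s)
    G≡ = shared-edge⇒neighbour (neighbour F s) (mirror F s) G onG N≢G
    B-back : BlockingSide σ (neighbour (neighbour F s) (mirror F s)) (mirror (neighbour F s) (mirror F s))
    B-back = subst₂ (BlockingSide σ) (sym (neighbour-involutive F s)) (sym (mirror-involutive F s)) B

  AlignedExceptBlocking : Bool → Face → Set
  AlignedExceptBlocking b F = ∀ s → ccwAt σ F s ≡ b ⊎ BlockingSide σ F s

  tower-height : ∀ F rest → IsTower C σ (F ∷ rest) →
                 Σ Bool λ b → AlignedExceptBlocking b F ×
                              height (lastOf F rest) ≡ height F ℤ.+ sign b ℤ.* + length rest
  tower-height F [] (_ , dir) =
    ccwAt σ F s₁ , (λ s → inj₁ (directed⇒uniform σ F dir s)) , no-steps (height F) (sign (ccwAt σ F s₁))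
    where
    no-steps : ∀ h x → h ≡ h ℤ.+ x ℤ.* + 0
    no-steps = solve-∀
  tower-height F (F' ∷ rest) (inF , F≢F' , (e , _ , onF' , adb) , tower)
    with almostDirected⇒blockingSide σ F e adb
  ... | s , refl , B with shared-edge⇒neighbour F s F' onF' F≢F'
  ... | refl with tower-height (neighbour F s) rest tower
  ... | b' , aligned' , height-last with aligned' (mirror F s)
  ...   | inj₂ B' = ⊥-elim (tower-cannot-turn-back F s rest B B' tower)
  ...   | inj₁ ccw≡b' =
    b , aligned , trans height-last (trans (cong₂ (λ x y → x ℤ.+ sign y ℤ.* + length rest) step b'≡b)
                                           (one-more (height F) (sign b) (length rest)))
    where
    b : Bool
    b = not (ccwAt σ F s)
    b'≡b : b' ≡ b
    b'≡b = trans (sym ccw≡b') (ccwAt-neighbour σ F s)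
    aligned : AlignedExceptBlocking b F
    aligned s' with B s'
    ... | inj₁ refl = inj₂ B
    ... | inj₂ opp  = inj₁ opp
    step : height (neighbour F s) ≡ height F ℤ.+ sign b
    step = step-height F s (inside-both⇒inG C F s inF (tower-inside (neighbour F s) rest tower))
    one-more : ∀ h x n → (h ℤ.+ x) ℤ.+ x ℤ.* + n ≡ h ℤ.+ x ℤ.* + suc n
    one-more h x n = trans (solve h x (+ n)) (cong (λ z → h ℤ.+ x ℤ.* z) (sym (ℤₚ.pos-+ 1 n)))
      where
      solve : ∀ h x m → (h ℤ.+ x) ℤ.+ x ℤ.* m ≡ h ℤ.+ x ℤ.* (+ 1 ℤ.+ m)
      solve = solve-∀

  tower-length≤ : ∀ F rest → IsTower C σ (F ∷ rest) → length rest ≤ ∣ height (lastOf F rest) ∣ + ∣ height F ∣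
  tower-length≤ F rest tower with tower-height F rest tower
  ... | b , _ , height-last =
    subst (_≤ ∣ height (lastOf F rest) ∣ + ∣ height F ∣) difference
          (ℤₚ.∣i-j∣≤∣i∣+∣j∣ (height (lastOf F rest)) (height F))
    where
    cancel : ∀ h y → (h ℤ.+ y) ℤ.- h ≡ y
    cancel = solve-∀
    ∣sign*n∣ : ∀ b n → ∣ sign b ℤ.* + n ∣ ≡ n
    ∣sign*n∣ true  n = cong ∣_∣ (ℤₚ.*-identityˡ (+ n))
    ∣sign*n∣ false n = trans (cong ∣_∣ (ℤₚ.-1*i≡-i (+ n))) (ℤₚ.∣-i∣≡∣i∣ (+ n))
    difference : ∣ height (lastOf F rest) ℤ.- height F ∣ ≡ length rest
    difference = trans (cong ∣_∣ (trans (cong (ℤ._- height F) height-last) (cancel (height F) _))) (∣sign*n∣ b (length rest))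

-- Area

row : ℤ → ℤ → ℕ → List Face
row a j zero    = []
row a j (suc m) = (a , j , up) ∷ (a , j , down) ∷ row (a ℤ.+ 1ℤ) j m

∈-row : ∀ a j m {X} → X ∈ row a j m → a ℤ.≤ proj₁ X × proj₁ (proj₂ X) ≡ j
∈-row a j (suc m) (here refl)         = ℤₚ.≤-refl , refl
∈-row a j (suc m) (there (here refl)) = ℤₚ.≤-refl , refl
∈-row a j (suc m) (there (there X∈))  with ∈-row (a ℤ.+ 1ℤ) j m X∈
... | a+1≤ , eq = ℤₚ.≤-trans (ℤₚ.<⇒≤ (i<i+1 a)) a+1≤ , eq

row-unique : ∀ a j m → Unique (row a j m)
row-unique a j zero    = []
row-unique a j (suc m) = ((λ ()) ∷ later up) ∷ (later down ∷ row-unique (a ℤ.+ 1ℤ) j m)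
  where
  later : ∀ o → All (λ Y → (a , j , o) ≢ Y) (row (a ℤ.+ 1ℤ) j m)
  later o = All.tabulate λ Y∈ eq →
    ℤₚ.<-irrefl refl (ℤₚ.<-≤-trans (i<i+1 a)
      (subst (λ Y → a ℤ.+ 1ℤ ℤ.≤ proj₁ Y) (sym eq) (proj₁ (∈-row (a ℤ.+ 1ℤ) j m Y∈))))

box : ℕ → ℤ → ℤ → ℕ → List Face
box m a r zero    = []
box m a r (suc n) = row a r m ++ box m a (r ℤ.+ 1ℤ) n

∈-box : ∀ m a r n {X} → X ∈ box m a r n → r ℤ.≤ proj₁ (proj₂ X)
∈-box m a r (suc n) X∈ with ∈-++⁻ (row a r m) X∈
... | inj₁ X∈row = ℤₚ.≤-reflexive (sym (proj₂ (∈-row a r m X∈row)))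
... | inj₂ X∈box = ℤₚ.≤-trans (ℤₚ.<⇒≤ (i<i+1 r)) (∈-box m a (r ℤ.+ 1ℤ) n X∈box)

box-unique : ∀ m a r n → Unique (box m a r n)
box-unique m a r zero    = []
box-unique m a r (suc n) = Uniqueₚ.++⁺ (row-unique a r m) (box-unique m a (r ℤ.+ 1ℤ) n) disjoint
  where
  disjoint : ∀ {X} → ¬ (X ∈ row a r m × X ∈ box m a (r ℤ.+ 1ℤ) n)
  disjoint (X∈row , X∈box) = ℤₚ.<-irrefl refl (ℤₚ.<-≤-trans (i<i+1 r)
    (subst (r ℤ.+ 1ℤ ℤ.≤_) (proj₂ (∈-row a r m X∈row)) (∈-box m a (r ℤ.+ 1ℤ) n X∈box)))

module Area (C : List Vertex) (cyc : IsCycle C) (σ : Orientation) (eu : Eulerian C σ)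
            (L : List Face) (inside⇒∈L : ∀ {F} → Inside C F → F ∈ L) where
  open Height C σ eu

  inside : Face → ℕ
  inside F = toℕ (insideᵇ C F)

  cell : ℤ → ℤ → ℕ
  cell k j = inside (k , j , up) + inside (k , j , down)

  count-row : ∀ a j m → count (insideᵇ C) (row a j m) ≡ ∑ℕ m (λ s → cell (a ℤ.+ + s) j)
  count-row a j zero    = refl
  count-row a j (suc m)
    rewrite count-∷ (insideᵇ C) (a , j , up) ((a , j , down) ∷ row (a ℤ.+ 1ℤ) j m)
          | count-∷ (insideᵇ C) (a , j , down) (row (a ℤ.+ 1ℤ) j m)
          | count-row (a ℤ.+ 1ℤ) j m =
    trans (sym (ℕₚ.+-assoc (inside (a , j , up)) _ _))
      (cong₂ _+_ (cong (λ z → cell z j) (sym (ℤₚ.+-identityʳ a)))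
                 (∑ℕ-cong m (λ s → cong (λ z → cell z j) (sym (i+[1+n]≡i+1+n a s)))))

  count-box : ∀ m a r n → count (insideᵇ C) (box m a r n) ≡ ∑ℕ n (λ t → count (insideᵇ C) (row a (r ℤ.+ + t) m))
  count-box m a r zero    = refl
  count-box m a r (suc n) = trans (count-++ (insideᵇ C) (row a r m) (box m a (r ℤ.+ 1ℤ) n))
    (cong₂ _+_ (cong (λ z → count (insideᵇ C) (row a z m)) (sym (ℤₚ.+-identityʳ r)))
      (trans (count-box m a (r ℤ.+ 1ℤ) n)
             (∑ℕ-cong n (λ t → cong (λ z → count (insideᵇ C) (row a z m)) (sym (i+[1+n]≡i+1+n r t))))))

  count-box≤ : ∀ m a r n → count (insideᵇ C) (box m a r n) ≤ length L
  count-box≤ m a r n = count≤length (insideᵇ C) (box-unique m a r n) (λ _ → inside⇒∈L)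

  ∣W∣≤adjacent : ∀ e → proj₂ (proj₂ e) ≢ hor → ∣ W e ∣ ≤ inside (proj₁ (adjFaces e)) + inside (proj₂ (adjFaces e))
  ∣W∣≤adjacent e ¬hor = ℕₚ.≤-trans (∣weight∣≤ (inGᵇ C e) (σ e)) (inG≤ (inGᵇ C e) refl)
    where
    inG≤ : ∀ g → inGᵇ C e ≡ g → toℕ g ≤ inside (proj₁ (adjFaces e)) + inside (proj₂ (adjFaces e))
    inG≤ false _  = z≤n
    inG≤ true  eq with inG⇒adjacent-inside C cyc e ¬hor (subst T (sym eq) tt)
    ... | inj₁ t = ℕₚ.≤-trans (ℕₚ.≤-reflexive (cong toℕ (sym (T⇒≡true t)))) (ℕₚ.m≤m+n _ _)
    ... | inj₂ t = ℕₚ.≤-trans (ℕₚ.≤-reflexive (cong toℕ (sym (T⇒≡true t)))) (ℕₚ.m≤n+m _ _)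

  ∣V∣≤cells : ∀ i j → ∣ V j (i ℤ.+ 1ℤ) ∣ ≤ ∑ℕ (reach i) (λ s → cell (i ℤ.+ + suc s) j + cell (i ℤ.+ + s) j)
  ∣V∣≤cells i j = begin
      ∣ V j (i ℤ.+ 1ℤ) ∣
    ≡⟨ cong ∣_∣ (ray≡window (i ℤ.+ 1ℤ) (reach i) (W-vanishes ver j) (R<a+1+reach i)) ⟩
      ∣ ∑ℤ (reach i) (λ s → W ((i ℤ.+ 1ℤ) ℤ.+ + s , j , ver)) ∣
    ≤⟨ ∣∑ℤ∣≤∑ℕ∣∣ (reach i) (λ s → W ((i ℤ.+ 1ℤ) ℤ.+ + s , j , ver)) ⟩
      ∑ℕ (reach i) (λ s → ∣ W ((i ℤ.+ 1ℤ) ℤ.+ + s , j , ver) ∣)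
    ≤⟨ ∑ℕ-mono (reach i) (λ s _ → ℕₚ.≤-trans (∣W∣≤adjacent ((i ℤ.+ 1ℤ) ℤ.+ + s , j , ver) (λ ()))
                                      (ℕₚ.+-mono-≤ (up≤ s) (down≤ s))) ⟩
      ∑ℕ (reach i) (λ s → cell (i ℤ.+ + suc s) j + cell (i ℤ.+ + s) j) ∎
    where
    open ℕₚ.≤-Reasoning
    up≤ : ∀ s → inside ((i ℤ.+ 1ℤ) ℤ.+ + s , j , up) ≤ cell (i ℤ.+ + suc s) j
    up≤ s = ℕₚ.≤-trans (ℕₚ.≤-reflexive (cong (λ z → inside (z , j , up)) (sym (i+[1+n]≡i+1+n i s)))) (ℕₚ.m≤m+n _ _)
    down≤ : ∀ s → inside (((i ℤ.+ 1ℤ) ℤ.+ + s) ℤ.- 1ℤ , j , down) ≤ cell (i ℤ.+ + s) j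
    down≤ s = ℕₚ.≤-trans (ℕₚ.≤-reflexive (cong (λ z → inside (z , j , down)) (i+1+t-1≡i+t i (+ s)))) (ℕₚ.m≤n+m _ _)

  ∣D∣≤cells : ∀ i j → ∣ D (j ℤ.+ 1ℤ) i ∣ ≤ ∑ℕ (reach i) (λ s → cell (i ℤ.+ + s) j)
  ∣D∣≤cells i j = ℕₚ.≤-trans (∣∑ℤ∣≤∑ℕ∣∣ (reach i) (λ s → W (i ℤ.+ + s , j ℤ.+ 1ℤ , dia)))
    (∑ℕ-mono (reach i) (λ s _ → ℕₚ.≤-trans (∣W∣≤adjacent (i ℤ.+ + s , j ℤ.+ 1ℤ , dia) (λ ()))
                                   (ℕₚ.≤-reflexive (cong (λ z → cell (i ℤ.+ + s) z) (i+1-1≡i j)))))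

  -- Every edge of G(C) crossed by the ray borders an inside face of the row;
  -- no cell is charged more than three times.
  ∣height∣≤row : ∀ i j → ∣ height (i , j , up) ∣ ≤ 3 * count (insideᵇ C) (row i j (suc (reach i)))
  ∣height∣≤row i j = begin
      ∣ height (i , j , up) ∣
    ≤⟨ ℤₚ.∣i-j∣≤∣i∣+∣j∣ (V j (i ℤ.+ 1ℤ)) (D (j ℤ.+ 1ℤ) i) ⟩
      ∣ V j (i ℤ.+ 1ℤ) ∣ + ∣ D (j ℤ.+ 1ℤ) i ∣
    ≤⟨ ℕₚ.+-mono-≤ (∣V∣≤cells i j) (∣D∣≤cells i j) ⟩
      ∑ℕ n (λ s → c (suc s) + c s) + ∑ℕ n c
    ≡⟨ cong (_+ ∑ℕ n c) (∑ℕ-+ n (c ∘ suc) c) ⟩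
      (∑ℕ n (c ∘ suc) + ∑ℕ n c) + ∑ℕ n c
    ≤⟨ ℕₚ.+-mono-≤ (ℕₚ.+-mono-≤ (∑ℕ-tail≤ n c) (∑ℕ≤∑ℕ-suc n c)) (∑ℕ≤∑ℕ-suc n c) ⟩
      (∑ℕ (suc n) c + ∑ℕ (suc n) c) + ∑ℕ (suc n) c
    ≡⟨ thrice (∑ℕ (suc n) c) ⟩
      3 * ∑ℕ (suc n) c
    ≡⟨ cong (3 *_) (count-row i j (suc n)) ⟨
      3 * count (insideᵇ C) (row i j (suc n)) ∎
    where
    open ℕₚ.≤-Reasoning
    n : ℕ
    n = reach i
    c : ℕ → ℕ
    c s = cell (i ℤ.+ + s) j
    thrice : ∀ x → x + x + x ≡ 3 * x
    thrice = ℕ-Ring.solve-∀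

  ∣height∣-climb : ∀ i r t → ∣ height (i , r , up) ∣ ≤ ∣ height (i , r ℤ.+ + t , up) ∣ + 2 * t
  ∣height∣-climb i r zero = ℕₚ.≤-reflexive (trans (cong (λ z → ∣ height (i , z , up) ∣) (sym (ℤₚ.+-identityʳ r)))
                                                (sym (ℕₚ.+-identityʳ _)))
  ∣height∣-climb i r (suc t) = begin
      ∣ height (i , r , up) ∣
    ≤⟨ ∣height∣-climb i r t ⟩
      ∣ height (i , r ℤ.+ + t , up) ∣ + 2 * t
    ≤⟨ ℕₚ.+-monoˡ-≤ (2 * t) (ℕₚ.≤-trans (∣height∣-across (i , r ℤ.+ + t , up) s₂)
                                       (ℕₚ.+-monoˡ-≤ 1 (∣height∣-across (i , r ℤ.+ + t , down) s₂))) ⟩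
      ∣ height (i , (r ℤ.+ + t) ℤ.+ 1ℤ , up) ∣ + 1 + 1 + 2 * t
    ≡⟨ two-more ∣ height (i , (r ℤ.+ + t) ℤ.+ 1ℤ , up) ∣ t ⟩
      ∣ height (i , (r ℤ.+ + t) ℤ.+ 1ℤ , up) ∣ + 2 * suc t
    ≡⟨ cong (λ z → ∣ height (i , z , up) ∣ + 2 * suc t) (i+n+1≡i+[1+n] r t) ⟩
      ∣ height (i , r ℤ.+ + suc t , up) ∣ + 2 * suc t ∎
    where
    open ℕₚ.≤-Reasoning
    two-more : ∀ x t → x + 1 + 1 + 2 * t ≡ x + 2 * suc t
    two-more = ℕ-Ring.solve-∀

  up-face-area : ∀ i r → let n = ∣ height (i , r , up) ∣ / 3 in n * n ≤ 3 * length L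
  up-face-area i r = begin
      n * n                                 ≡⟨ ∑ℕ-const n n ⟨
      ∑ℕ n (λ _ → n)                        ≤⟨ ∑ℕ-mono n n≤3rc ⟩
      ∑ℕ n (λ t → 3 * rc t)                 ≡⟨ ∑ℕ-*ˡ n 3 rc ⟩
      3 * ∑ℕ n rc                           ≡⟨ cong (3 *_) (count-box M i r n) ⟨
      3 * count (insideᵇ C) (box M i r n)   ≤⟨ ℕₚ.*-monoʳ-≤ 3 (count-box≤ M i r n) ⟩
      3 * length L                          ∎
    where
    open ℕₚ.≤-Reasoning
    m n M : ℕ
    m = ∣ height (i , r , up) ∣
    n = m / 3
    M = suc (reach i)
    rc : ℕ → ℕ
    rc t = count (insideᵇ C) (row i (r ℤ.+ + t) M)
    -- Row t < n above has height ≥ m - 2t ≥ n + 2 (n - t), and a row's height is at most 3 rc t.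
    n≤3rc : ∀ t → t < n → n ≤ 3 * rc t
    n≤3rc t t<n = ℕₚ.+-cancelʳ-≤ (2 * n) n (3 * rc t) (begin
      n + 2 * n                                   ≡⟨ triple n ⟩
      n * 3                                       ≤⟨ m/n*n≤m m 3 ⟩
      m                                           ≤⟨ ∣height∣-climb i r t ⟩
      ∣ height (i , r ℤ.+ + t , up) ∣ + 2 * t     ≤⟨ ℕₚ.+-mono-≤ (∣height∣≤row i (r ℤ.+ + t)) (ℕₚ.*-monoʳ-≤ 2 (ℕₚ.<⇒≤ t<n)) ⟩
      3 * rc t + 2 * n                            ∎)
      where
      triple : ∀ n → n + 2 * n ≡ n * 3
      triple = ℕ-Ring.solve-∀

  up-face-above : ∀ F → Σ ℤ λ i → Σ ℤ λ r → ∣ height F ∣ ≤ ∣ height (i , r , up) ∣ + 1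
  up-face-above (i , j , up)   = i , j , ℕₚ.m≤m+n _ 1
  up-face-above (i , j , down) = i , j ℤ.+ 1ℤ , ∣height∣-across (i , j , down) s₂

  HeightBound : Face → Set
  HeightBound F = Σ ℕ λ n → ∣ height F ∣ ≤ 3 * n + 3 × n * n ≤ 3 * length L

  ∣height∣≤ : ∀ F → HeightBound F
  ∣height∣≤ F with up-face-above F
  ... | i , r , F≤ =
    n , ℕₚ.≤-trans F≤ (ℕₚ.≤-trans (ℕₚ.+-monoˡ-≤ 1 m≤3n+2) (ℕₚ.≤-reflexive (ℕₚ.+-assoc (3 * n) 2 1))) ,
    up-face-area i r
    where
    m n : ℕ
    m = ∣ height (i , r , up) ∣
    n = m / 3
    m≤3n+2 : m ≤ 3 * n + 2
    m≤3n+2 = begin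
      m                   ≡⟨ m≡m%n+[m/n]*n m 3 ⟩
      m % 3 + n * 3       ≤⟨ ℕₚ.+-monoˡ-≤ (n * 3) (ℕₚ.≤-pred (m%n<n m 3)) ⟩
      2 + n * 3           ≡⟨ ℕₚ.+-comm 2 (n * 3) ⟩
      n * 3 + 2           ≡⟨ cong (_+ 2) (ℕₚ.*-comm n 3) ⟩
      3 * n + 2           ∎
      where open ℕₚ.≤-Reasoning

square≤500 : ∀ ℓ n f → ℓ ≤ 6 * n + 7 → n * n ≤ 3 * f → 1 ≤ f → ℓ * ℓ ≤ 500 * f
square≤500 ℓ n f ℓ≤ n²≤ 1≤f = begin
  ℓ * ℓ                                  ≤⟨ ℕₚ.*-mono-≤ ℓ≤ ℓ≤ ⟩
  (6 * n + 7) * (6 * n + 7)              ≡⟨ expand n ⟩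
  36 * (n * n) + 84 * n + 49             ≤⟨ ℕₚ.+-monoˡ-≤ 49 (ℕₚ.+-monoʳ-≤ (36 * (n * n)) (ℕₚ.*-monoʳ-≤ 84 (n≤n*n n))) ⟩
  36 * (n * n) + 84 * (n * n) + 49       ≡⟨ collect (n * n) ⟩
  120 * (n * n) + 49                     ≤⟨ ℕₚ.+-mono-≤ (ℕₚ.*-monoʳ-≤ 120 n²≤) (ℕₚ.*-monoʳ-≤ 49 1≤f) ⟩
  120 * (3 * f) + 49 * f                 ≡⟨ collect′ f ⟩
  409 * f                                ≤⟨ ℕₚ.*-monoˡ-≤ f (ℕₚ.m≤m+n 409 91) ⟩
  500 * f                                ∎
  where
  open ℕₚ.≤-Reasoning
  expand : ∀ n → (6 * n + 7) * (6 * n + 7) ≡ 36 * (n * n) + 84 * n + 49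
  expand = ℕ-Ring.solve-∀
  collect : ∀ x → 36 * x + 84 * x + 49 ≡ 120 * x + 49
  collect = ℕ-Ring.solve-∀
  collect′ : ∀ f → 120 * (3 * f) + 49 * f ≡ 409 * f
  collect′ = ℕ-Ring.solve-∀
  n≤n*n : ∀ n → n ≤ n * n
  n≤n*n zero    = z≤n
  n≤n*n (suc k) = ℕₚ.m≤m*n (suc k) (suc k)

square≤500-max : ∀ ℓ a b f → ℓ ≤ suc ((3 * a + 3) + (3 * b + 3)) → a * a ≤ 3 * f → b * b ≤ 3 * f → 1 ≤ f →
                 ℓ * ℓ ≤ 500 * f
square≤500-max ℓ a b f ℓ≤ a²≤ b²≤ 1≤f = square≤500 ℓ (a ℕ.⊔ b) f ℓ≤6max+7 max²≤ 1≤f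
  where
  grow : ∀ {x y} → x ≤ y → 3 * x + 3 ≤ 3 * y + 3
  grow x≤y = ℕₚ.+-monoˡ-≤ 3 (ℕₚ.*-monoʳ-≤ 3 x≤y)
  twice : ∀ n → suc ((3 * n + 3) + (3 * n + 3)) ≡ 6 * n + 7
  twice = ℕ-Ring.solve-∀
  ℓ≤6max+7 : ℓ ≤ 6 * (a ℕ.⊔ b) + 7
  ℓ≤6max+7 = ℕₚ.≤-trans ℓ≤ (ℕₚ.≤-trans (s≤s (ℕₚ.+-mono-≤ (grow (ℕₚ.m≤m⊔n a b)) (grow (ℕₚ.m≤n⊔m a b))))
                                        (ℕₚ.≤-reflexive (twice (a ℕ.⊔ b))))
  max²≤ : (a ℕ.⊔ b) * (a ℕ.⊔ b) ≤ 3 * f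
  max²≤ with ℕₚ.⊔-sel a b
  ... | inj₁ max≡a rewrite max≡a = a²≤
  ... | inj₂ max≡b rewrite max≡b = b²≤

module _ (C : List Vertex) (cyc : IsCycle C) (σ : Orientation) (eu : Eulerian C σ)
         (L : List Face) (inside⇒∈L : ∀ {F} → Inside C F → F ∈ L) where
  open Towers C σ eu
  open Area C cyc σ eu L inside⇒∈L

  tower-length² : ∀ F rest → IsTower C σ (F ∷ rest) → length (F ∷ rest) * length (F ∷ rest) ≤ 500 * length L
  tower-length² F rest tower = combine (∣height∣≤ F) (∣height∣≤ (lastOf F rest))
    where
    combine : HeightBound F → HeightBound (lastOf F rest) → length (F ∷ rest) * length (F ∷ rest) ≤ 500 * length L
    combine (a , F≤ , a²≤) (b , last≤ , b²≤) =
      square≤500-max (length (F ∷ rest)) b a (length L)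
        (s≤s (ℕₚ.≤-trans (tower-length≤ F rest tower) (ℕₚ.+-mono-≤ last≤ F≤)))
        b²≤ a²≤ (∈-length (inside⇒∈L {F} (tower-inside F rest tower)))

lemma10 : Σ ℕ (λ c → 0 < c ×
            ((C : List Vertex) → IsCycle C →
             (L : List Face) → Unique L → ((F : Face) → (F ∈ L) ⇔ Inside C F) →
             (σ : Orientation) → Eulerian C σ →
             (T : List Face) → IsTower C σ T →
             length T * length T ≤ c * length L))
lemma10 = 500 , s≤s z≤n , λ where
  C cyc L _ L⇔ σ eu (F ∷ rest) tower →
    tower-length² C cyc σ eu L (λ {F} → Equivalence.from (L⇔ F)) F rest tower
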